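{- For all $n,k\in\mathbb{N}$, $$c_B[n,k]=\sum_{\pi\in c_B(\langle n\rangle',k)} q^{\operatorname{inv}\pi}.$$
   Context: $[m]=(1-q^m)/(1-q)$; $c_B[n,k]$ is defined by $c_B[0,k]=\delta_{0,k}$ ($k\in\mathbb{Z}$) and $c_B[n,k]=c_B[n-1,k-1]+[2n-1]c_B[n-1,k]$ for $n\ge 1$. Let $\langle n\rangle'=\{ -n,\ldots,-1,1,\ldots,n\}$. A signed permutation is a bijection $\pi$ of $\langle n\rangle'$ with $\pi(-i)=-\pi(i)$ for all $i$. Each cycle $c=(a_1,\ldots,a_r)$ of $\pi$ is either paired, meaning it contains no $i$ together with $-i$, in which case $-c=(-a_1,\ldots,-a_r)$ is also a cycle of $\pi$; or unpaired, meaning it has the form $(a_1,\ldots,a_r,-a_1,\ldots,-a_r)$. $c_B(\langle n\rangle',k)$ is the set of signed permutations of $\langle n\rangle'$ with exactly $2k$ paired cycles. Standard form: list the cycles $c_1c_2\cdots c_\ell$ so that, with $m_i=\min\{|a|:a\in c_i\}$, (1) $m_1\le m_2\le\cdots\le m_\ell$; (2) if $m_i=m_{i+1}$ then $-m_i\in c_i$ and $m_{i+1}\in c_{i+1}$; (3) each $c_i$ is written with its element $\pm m_i$ last, unpaired cycles being written to end in $-m_i$. Let $w=w_1w_2\cdots w_{2n}$ be the word obtained by erasing the parentheses of the standard form. Then $\operatorname{inv}\pi=\#\{(i,j): i<j,\ w_i>|w_j|\}$. -}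

module Defs where

open import Function using (_∘_)
open import Data.Bool using (Bool; true; false; not; if_then_else_; _∧_)
open import Data.Bool.Properties using () renaming (_≟_ to _≟B_)
open import Data.Nat using (ℕ; zero; suc; _+_; _*_; _≤ᵇ_)
open import Data.Fin using (Fin; toℕ)
open import Data.Fin.Properties using () renaming (_≟_ to _≟F_)
open import Data.Product using (_×_; _,_; proj₁; proj₂)
open import Data.List using (List; []; _∷_; _++_; map; concatMap; length; filterᵇ; allFin; replicate)
open import Data.Bool.ListAction using (all; any)
open import Data.Vec using (Vec; lookup; toList) renaming ([] to []ᵥ; _∷_ to _∷ᵥ_)
open import Data.Integer using (ℤ; +_; -[1+_]; ∣_∣) renaming (_<?_ to _<ℤ?_)
open import Relation.Nullary.Decidable using (⌊_⌋)
import Data.List.Relation.Unary.Unique.DecPropositional as UniqueDec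

-- Polynomials in q with natural-number coefficients, as coefficient
-- lists (constant term first).  Equality is compared coefficientwise
-- via 'coeff'.

Poly : Set
Poly = List ℕ

infixl 6 _⊕_
infixl 7 _⊛_

_⊕_ : Poly → Poly → Poly
[] ⊕ q = q
(a ∷ p) ⊕ [] = a ∷ p
(a ∷ p) ⊕ (b ∷ q) = (a + b) ∷ (p ⊕ q)

_⊛_ : Poly → Poly → Poly
[] ⊛ q = []
(a ∷ p) ⊛ q = map (a *_) q ⊕ (0 ∷ (p ⊛ q))

coeff : Poly → ℕ → ℕ
coeff [] _ = 0
coeff (a ∷ p) zero = a
coeff (a ∷ p) (suc d) = coeff p d

-- [m] = (1 - q^m)/(1 - q) = 1 + q + ... + q^(m-1)
qint : ℕ → Poly
qint m = replicate m 1

-- c_B[n,k] for k ∈ ℕ.  c_B[0,k] = δ_{0,k};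
-- c_B[n,k] = c_B[n-1,k-1] + [2n-1] c_B[n-1,k]  (n ≥ 1),
-- where c_B[n-1,-1] = 0 (all c_B[n,k] with k < 0 vanish).
-- For n = suc m, 2n - 1 = 2m + 1.
cB : ℕ → ℕ → Poly
cB zero zero = 1 ∷ []
cB zero (suc k) = []
cB (suc m) zero = qint (2 * m + 1) ⊛ cB m zero
cB (suc m) (suc k) = cB m k ⊕ qint (2 * m + 1) ⊛ cB m (suc k)

-- Elements of ⟨n⟩' = {-n,…,-1,1,…,n}: (false , i) denotes i+1 and
-- (true , i) denotes -(i+1), for i : Fin n.

Elt : ℕ → Set
Elt n = Bool × Fin n

negE : ∀ {n} → Elt n → Elt n
negE (s , i) = (not s , i)

-- |x| - 1
absE : ∀ {n} → Elt n → ℕ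
absE (s , i) = toℕ i

eqE : ∀ {n} → Elt n → Elt n → Bool
eqE (s , i) (t , j) = ⌊ s ≟B t ⌋ ∧ ⌊ i ≟F j ⌋

toℤ : ∀ {n} → Elt n → ℤ
toℤ (false , i) = + suc (toℕ i)
toℤ (true , i) = -[1+ toℕ i ]

allElts : ∀ n → List (Elt n)
allElts n = concatMap (λ i → (false , i) ∷ (true , i) ∷ []) (allFin n)

-- A candidate signed permutation: the values π(1),…,π(n).
-- π(-i) = -π(i) is built in by 'apply'.
SVec : ℕ → Set
SVec n = Vec (Elt n) n

apply : ∀ {n} → SVec n → Elt n → Elt n
apply v (false , i) = lookup v i
apply v (true , i) = negE (lookup v i)

allVecs : ∀ {A : Set} → List A → (m : ℕ) → List (Vec A m)
allVecs xs zero = []ᵥ ∷ []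
allVecs xs (suc m) = concatMap (λ x → map (x ∷ᵥ_) (allVecs xs m)) xs

module UniqFin {n : ℕ} = UniqueDec (_≟F_ {n})

-- the signed permutations of ⟨n⟩': those v for which i ↦ |π(i)| is a
-- bijection of {1,…,n} (equivalently π is a bijection of ⟨n⟩')
signedPerms : ∀ n → List (SVec n)
signedPerms n =
  Data.List.filter (λ v → UniqFin.unique? (map proj₂ (toList v)))
                   (allVecs (allElts n) n)

-- the cycle of π through x, written so that it ends with x:
-- π(x), π²(x), …, x   (fuel 2n bounds the cycle length)
cycleEnding : ∀ {n} → SVec n → Elt n → List (Elt n)
cycleEnding {n} v x = go (2 * n) (apply v x)
  where
  go : ℕ → Elt n → List (Elt n)
  go zero y = x ∷ []
  go (suc f) y = if eqE y x then x ∷ [] else y ∷ go f (apply v y)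

member : ∀ {n} → Elt n → List (Elt n) → Bool
member x xs = any (eqE x) xs

isCycleMin : ∀ {n} → SVec n → Elt n → Bool
isCycleMin v x = all (λ y → absE x ≤ᵇ absE y) (cycleEnding v x)

unpairedAt : ∀ {n} → SVec n → Elt n → Bool
unpairedAt v x = member (negE x) (cycleEnding v x)

-- number of paired cycles: each paired cycle has a unique element of
-- minimal absolute value, so count those elements x whose cycle is paired
pairedCycles : ∀ {n} → SVec n → ℕ
pairedCycles {n} v =
  length (filterᵇ (λ x → isCycleMin v x ∧ not (unpairedAt v x)) (allElts n))

-- the word obtained from the standard form: for m = 1,…,n in increasing
-- order, if m is the minimal absolute value of its cycle, write either
-- the unpaired cycle ending in -m, or the paired cycle containing -m
-- (ending in -m) followed by the cycle containing m (ending in m).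
standardWord : ∀ {n} → SVec n → List (Elt n)
standardWord {n} v = concatMap block (allFin n)
  where
  block : Fin n → List (Elt n)
  block m =
    if isCycleMin v (false , m)
    then (if unpairedAt v (false , m)
          then cycleEnding v (true , m)
          else cycleEnding v (true , m) ++ cycleEnding v (false , m))
    else []

invWord : List ℤ → ℕ
invWord [] = 0
invWord (x ∷ xs) = length (filterᵇ (λ y → ⌊ + ∣ y ∣ <ℤ? x ⌋) xs) + invWord xs

inv : ∀ {n} → SVec n → ℕ
inv v = invWord (map toℤ (standardWord v))

{-# OPTIONS --safe #-}
-- A signed permutation of ⟨n+1⟩' is obtained from exactly one signed permutation
-- of ⟨n⟩' by letting n+1 enter in one of 2n+2 ways: as the two new paired cycles
-- (n+1)(-n-1), as the new unpaired cycle (n+1,-n-1), or into the cycle of a letter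
-- y, just before y (and -n-1 just before -y). The standard word changes by
-- appending -n-1,n+1 or n+1,-n-1, or by inserting n+1 before y and -n-1 before -y.
-- The first way adds two paired cycles and no inversion, the second keeps both
-- statistics, and inserting before the j-th letter from the end keeps the paired
-- cycles and adds j inversions, since n+1 exceeds |w| for every later letter w while
-- -n-1 exceeds nothing. Hence c_B[n+1,k] = c_B[n,k-1] + [2n+1] c_B[n,k].
module Submission where

open import Defs
open import Function using (_∘_; _$_; id; case_of_)
open import Function.Bundles using (Injection; _↣_; Equivalence; mk⇔)
open import Function.Properties.Inverse using (↔-sym; ↔⇒↣)
open import Function.Definitions using (Injective)
open import Data.Empty using (⊥-elim)
open import Data.Bool using (Bool; true; false; not; _∧_; _∨_; if_then_else_)
open import Data.Bool.Properties using (not-involutive; T-≡; ∧-zeroʳ) renaming (_≟_ to _≟B_)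
open import Data.Bool.ListAction using (all; any; and; or)
open import Data.Nat using (ℕ; zero; suc; _+_; _*_; _≤_; _<_; _≤ᵇ_; _≟_; z≤n; s≤s; s<s⁻¹)
import Data.Nat.Properties as ℕ
open import Data.Nat.ListAction using (sum)
open import Data.Nat.ListAction.Properties using (sum-++; sum-↭)
open import Data.Nat.Solver using (module +-*-Solver)
open import Algebra.Properties.CommutativeSemigroup ℕ.+-commutativeSemigroup using (interchange)
open import Data.Integer as ℤ using (ℤ; ∣_∣) renaming (_<?_ to _<ℤ?_)
import Data.Integer.Properties as ℤ
open import Data.Fin using (Fin; toℕ; fromℕ; inject₁; combine)
import Data.Fin.Properties as Fin
import Data.Fin.Relation.Unary.Top as Top
open import Data.Product using (∃; _×_; _,_; proj₁; proj₂; map₂)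
open import Data.Product.Properties using (≡-dec)
open import Data.Sum using (_⊎_; inj₁; inj₂)
open import Data.List as List using (List; []; _∷_; _++_; [_]; map; concatMap; length; filter; filterᵇ; allFin; upTo; applyUpTo)
import Data.List.Properties as List
open import Data.List.Membership.Propositional using (_∈_; _∉_)
import Data.List.Membership.Propositional.Properties as List∈
open import Data.List.Membership.Propositional.Properties.WithK using (unique∧set⇒bag)
open import Data.List.Relation.Unary.Any using (here; there)
open import Data.List.Relation.Unary.All as All using (All; []; _∷_)
import Data.List.Relation.Unary.All.Properties as All
import Data.List.Relation.Unary.AllPairs as AllPairs
import Data.List.Relation.Unary.AllPairs.Properties as AllPairs
open import Data.List.Relation.Unary.AllPairs using ([]; _∷_)
open import Data.List.Relation.Unary.Unique.Propositional using (Unique)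
import Data.List.Relation.Unary.Unique.Propositional.Properties as Unique
open import Data.List.Relation.Binary.Disjoint.Propositional using (Disjoint)
open import Data.List.Relation.Binary.Permutation.Propositional using (_↭_)
import Data.List.Relation.Binary.Permutation.Propositional.Properties as ↭
open import Data.List.Relation.Binary.BagAndSetEquality using (∼bag⇒↭)
open import Data.Vec as Vec using (Vec; lookup; tabulate; toList; _∷ʳ_)
import Data.Vec.Properties as Vec
open import Relation.Binary.Definitions using (DecidableEquality)
open import Relation.Binary.PropositionalEquality hiding ([_])
open import Relation.Nullary using (yes; no; does; contradiction)
open import Relation.Nullary.Decidable using (⌊_⌋; _×-dec_; T?)
open import Relation.Unary using (Pred; Decidable)

private
  variable
    A B : Set

𝟙 : Bool → ℕ
𝟙 b = if b then 1 else 0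

∑ : (A → ℕ) → List A → ℕ
∑ f xs = sum (map f xs)

∑-++ : ∀ (f : A → ℕ) xs ys → ∑ f (xs ++ ys) ≡ ∑ f xs + ∑ f ys
∑-++ f xs ys = trans (cong sum (List.map-++ f xs ys)) (sum-++ (map f xs) (map f ys))

∑-map : ∀ (f : B → ℕ) (g : A → B) xs → ∑ f (map g xs) ≡ ∑ (f ∘ g) xs
∑-map f g xs = cong sum (sym (List.map-∘ xs))

∑-concatMap : ∀ (f : B → ℕ) (g : A → List B) xs → ∑ f (concatMap g xs) ≡ ∑ (∑ f ∘ g) xs
∑-concatMap f g [] = refl
∑-concatMap f g (x ∷ xs) = trans (∑-++ f (g x) (concatMap g xs)) (cong (∑ f (g x) +_) (∑-concatMap f g xs))

∑-cong : ∀ {f g : A → ℕ} {xs} → All (λ x → f x ≡ g x) xs → ∑ f xs ≡ ∑ g xs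
∑-cong eqs = cong sum (List.map-cong-local eqs)

∑-cong-∈ : ∀ {f g : A → ℕ} xs → (∀ {x} → x ∈ xs → f x ≡ g x) → ∑ f xs ≡ ∑ g xs
∑-cong-∈ xs eq = ∑-cong (All.tabulate eq)

∑-zero : ∀ {f : A → ℕ} xs → (∀ x → f x ≡ 0) → ∑ f xs ≡ 0
∑-zero [] _ = refl
∑-zero (x ∷ xs) f≡0 = cong₂ _+_ (f≡0 x) (∑-zero xs f≡0)

∑-one : ∀ {f : A → ℕ} xs → (∀ x → f x ≡ 1) → ∑ f xs ≡ length xs
∑-one [] _ = refl
∑-one (x ∷ xs) f≡1 = cong₂ _+_ (f≡1 x) (∑-one xs f≡1)

∑-+ : ∀ (f g : A → ℕ) xs → ∑ (λ x → f x + g x) xs ≡ ∑ f xs + ∑ g xs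
∑-+ f g [] = refl
∑-+ f g (x ∷ xs) = trans (cong (f x + g x +_) (∑-+ f g xs)) (interchange (f x) (g x) (∑ f xs) (∑ g xs))

∑-comm : ∀ (f : A → B → ℕ) xs ys → ∑ (λ x → ∑ (f x) ys) xs ≡ ∑ (λ y → ∑ (λ x → f x y) xs) ys
∑-comm f [] ys = sym (∑-zero ys (λ _ → refl))
∑-comm f (x ∷ xs) ys = trans (cong (∑ (f x) ys +_) (∑-comm f xs ys))
                             (sym (∑-+ (f x) (λ y → ∑ (λ x → f x y) xs) ys))

∑-↭ : ∀ (f : A → ℕ) {xs ys} → xs ↭ ys → ∑ f xs ≡ ∑ f ys
∑-↭ f xs↭ys = sum-↭ (↭.map⁺ f xs↭ys)

∑-upTo-suc : ∀ (h : ℕ → ℕ) r → ∑ h (upTo (suc r)) ≡ h 0 + ∑ (h ∘ suc) (upTo r)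
∑-upTo-suc h r = cong (h 0 +_) (begin
  sum (map h (applyUpTo suc r))   ≡⟨ cong sum (List.map-applyUpTo suc h r) ⟩
  sum (applyUpTo (h ∘ suc) r)     ≡⟨ cong sum (List.map-applyUpTo id (h ∘ suc) r) ⟨
  ∑ (h ∘ suc) (upTo r)            ∎)
  where open ≡-Reasoning

∑-upTo-last : ∀ (h : ℕ → ℕ) r → ∑ h (upTo (suc r)) ≡ ∑ h (upTo r) + h r
∑-upTo-last h r = trans (cong (∑ h) (sym (List.upTo-∷ʳ r)))
                        (trans (∑-++ h (upTo r) (r ∷ [])) (cong (∑ h (upTo r) +_) (ℕ.+-identityʳ (h r))))

length-filter : ∀ {p} {P : Pred A p} (P? : Decidable P) xs → length (filter P? xs) ≡ ∑ (𝟙 ∘ does ∘ P?) xs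
length-filter P? [] = refl
length-filter P? (x ∷ xs) with does (P? x)
... | true = cong suc (length-filter P? xs)
... | false = length-filter P? xs

Unique-concatMap : ∀ {g : A → List B} {xs} → All (Unique ∘ g) xs →
                   (∀ {x x′} → x ≢ x′ → Disjoint (g x) (g x′)) → Unique xs → Unique (concatMap g xs)
Unique-concatMap unique-g disjoint-g unique-xs =
  Unique.concat⁺ (All.map⁺ unique-g) (AllPairs.map⁺ (AllPairs.map disjoint-g unique-xs))

∈-concatMap-intro : ∀ (g : A → List B) {x a xs} → x ∈ g a → a ∈ xs → x ∈ concatMap g xs
∈-concatMap-intro g {xs = y ∷ ys} x∈ (here refl) = List∈.∈-++⁺ˡ x∈
∈-concatMap-intro g {xs = y ∷ ys} x∈ (there a∈) = List∈.∈-++⁺ʳ (g y) (∈-concatMap-intro g x∈ a∈)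

∈-concatMap-elim : ∀ (g : A → List B) {x} xs → x ∈ concatMap g xs → ∃ λ a → a ∈ xs × x ∈ g a
∈-concatMap-elim g (y ∷ ys) x∈ with List∈.∈-++⁻ (g y) x∈
... | inj₁ x∈gy = y , here refl , x∈gy
... | inj₂ x∈rest with ∈-concatMap-elim g ys x∈rest
... | a , a∈ , x∈ga = a , there a∈ , x∈ga

Unique-tabulate⁻ : ∀ {n} {g : Fin n → A} → Unique (List.tabulate g) → Injective _≡_ _≡_ g
Unique-tabulate⁻ {n = suc n} (g0∉ ∷ u) {Fin.zero} {Fin.zero} _ = refl
Unique-tabulate⁻ {n = suc n} (g0∉ ∷ u) {Fin.zero} {Fin.suc j} eq = ⊥-elim (All.tabulate⁻ g0∉ j eq)
Unique-tabulate⁻ {n = suc n} (g0∉ ∷ u) {Fin.suc i} {Fin.zero} eq = ⊥-elim (All.tabulate⁻ g0∉ i (sym eq))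
Unique-tabulate⁻ {n = suc n} (g0∉ ∷ u) {Fin.suc i} {Fin.suc j} eq = cong Fin.suc (Unique-tabulate⁻ u eq)

tabulate-suc : ∀ {n} (f : Fin (suc n) → A) →
               List.tabulate f ≡ List.tabulate (f ∘ inject₁) ++ [ f (fromℕ n) ]
tabulate-suc {n = zero} f = refl
tabulate-suc {n = suc n} f = cong (f Fin.zero ∷_) (tabulate-suc (f ∘ Fin.suc))

≤ᵇ-true : ∀ {m n} → m ≤ n → (m ≤ᵇ n) ≡ true
≤ᵇ-true m≤n = Equivalence.to T-≡ (ℕ.≤⇒≤ᵇ m≤n)

≤ᵇ-false : ∀ {m n} → n < m → (m ≤ᵇ n) ≡ false
≤ᵇ-false {m} {n} n<m with m ≤ᵇ n in eq
... | false = refl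
... | true = contradiction (ℕ.≤ᵇ⇒≤ m n (Equivalence.from T-≡ eq)) (ℕ.<⇒≱ n<m)

≤ᵇ-refl : ∀ m → (m ≤ᵇ m) ≡ true
≤ᵇ-refl m = ≤ᵇ-true {m} {m} ℕ.≤-refl

lookup-∷ʳ-last : ∀ {n} (xs : Vec A n) x → lookup (xs ∷ʳ x) (fromℕ n) ≡ x
lookup-∷ʳ-last Vec.[] x = refl
lookup-∷ʳ-last (_ Vec.∷ xs) x = lookup-∷ʳ-last xs x

lookup-∷ʳ-inject₁ : ∀ {n} (xs : Vec A n) x i → lookup (xs ∷ʳ x) (inject₁ i) ≡ lookup xs i
lookup-∷ʳ-inject₁ (_ Vec.∷ xs) x Fin.zero = refl
lookup-∷ʳ-inject₁ (_ Vec.∷ xs) x (Fin.suc i) = lookup-∷ʳ-inject₁ xs x i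

Vec-map-injective : ∀ {f : A → B} {n} → Injective _≡_ _≡_ f → Injective _≡_ _≡_ (Vec.map {n = n} f)
Vec-map-injective f-inj {Vec.[]} {Vec.[]} _ = refl
Vec-map-injective f-inj {x Vec.∷ xs} {y Vec.∷ ys} eq with Vec.∷-injective eq
... | fx≡fy , eq′ = cong₂ Vec._∷_ (f-inj fx≡fy) (Vec-map-injective f-inj eq′)

toList-tabulate-lookup : ∀ {n} (u : Vec A n) → toList u ≡ List.tabulate (lookup u)
toList-tabulate-lookup Vec.[] = refl
toList-tabulate-lookup (x Vec.∷ u) = cong (x ∷_) (toList-tabulate-lookup u)

_≟E_ : ∀ {n} → DecidableEquality (Elt n)
_≟E_ = ≡-dec _≟B_ Fin._≟_

eqE-refl : ∀ {n} (a : Elt n) → eqE a a ≡ true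
eqE-refl (s , i) with s ≟B s | i Fin.≟ i
... | yes _ | yes _ = refl
... | no s≢s | _ = ⊥-elim (s≢s refl)
... | yes _ | no i≢i = ⊥-elim (i≢i refl)

eqE-≢ : ∀ {n} {a b : Elt n} → a ≢ b → eqE a b ≡ false
eqE-≢ {a = s , i} {t , j} a≢b with s ≟B t | i Fin.≟ j
... | yes refl | yes refl = ⊥-elim (a≢b refl)
... | no _ | _ = refl
... | yes _ | no _ = refl

negE-involutive : ∀ {n} (a : Elt n) → negE (negE a) ≡ a
negE-involutive (s , i) = cong (_, i) (not-involutive s)

negE≢self : ∀ {n} (a : Elt n) → negE a ≢ a
negE≢self (false , i) ()
negE≢self (true , i) ()

negE-injective : ∀ {n} → Injective _≡_ _≡_ (negE {n})
negE-injective {x = a} {b} eq =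
  trans (sym (negE-involutive a)) (trans (cong negE eq) (negE-involutive b))

sameAbs⇒≡⊎≡negE : ∀ {n} (a b : Elt n) → proj₂ a ≡ proj₂ b → a ≡ b ⊎ a ≡ negE b
sameAbs⇒≡⊎≡negE (false , i) (false , .i) refl = inj₁ refl
sameAbs⇒≡⊎≡negE (true , i) (true , .i) refl = inj₁ refl
sameAbs⇒≡⊎≡negE (false , i) (true , .i) refl = inj₂ refl
sameAbs⇒≡⊎≡negE (true , i) (false , .i) refl = inj₂ refl

lift : ∀ {n} → Elt n → Elt (suc n)
lift (s , i) = s , inject₁ i

newPos newNeg : ∀ {n} → Elt (suc n)
newPos {n} = false , fromℕ n
newNeg {n} = true , fromℕ n

lift-injective : ∀ {n} → Injective _≡_ _≡_ (lift {n})
lift-injective {x = s , i} {t , j} eq = cong₂ _,_ (cong proj₁ eq) (Fin.inject₁-injective (cong proj₂ eq))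

lift≢new : ∀ {n} (a : Elt n) s → lift a ≢ (s , fromℕ n)
lift≢new a s eq = Fin.fromℕ≢inject₁ (sym (cong proj₂ eq))

lift-negE : ∀ {n} (a : Elt n) → lift (negE a) ≡ negE (lift a)
lift-negE (s , i) = refl

absE-lift : ∀ {n} (a : Elt n) → absE (lift a) ≡ absE a
absE-lift (s , i) = Fin.toℕ-inject₁ i

absE-new : ∀ {n} s → absE {suc n} (s , fromℕ n) ≡ n
absE-new {n} s = Fin.toℕ-fromℕ n

absE<n : ∀ {n} (a : Elt n) → absE a < n
absE<n (s , i) = Fin.toℕ<n i

toℤ-lift : ∀ {n} (a : Elt n) → toℤ (lift a) ≡ toℤ a
toℤ-lift (false , i) = cong (λ k → ℤ.+ suc k) (Fin.toℕ-inject₁ i)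
toℤ-lift (true , i) = cong ℤ.-[1+_] (Fin.toℕ-inject₁ i)

eqE-lift : ∀ {n} (a b : Elt n) → eqE (lift a) (lift b) ≡ eqE a b
eqE-lift a b with a ≟E b
... | yes refl = trans (eqE-refl (lift a)) (sym (eqE-refl a))
... | no a≢b = trans (eqE-≢ (a≢b ∘ lift-injective)) (sym (eqE-≢ a≢b))

data EltView {n} : Elt (suc n) → Set where
  new : ∀ s → EltView (s , fromℕ n)
  lifted : ∀ a → EltView (lift a)

eltView : ∀ {n} (z : Elt (suc n)) → EltView z
eltView (s , k) with Top.view k
... | Top.‵fromℕ = new s
... | Top.‵inject₁ i = lifted (s , i)

allFin-suc : ∀ n → allFin (suc n) ≡ map inject₁ (allFin n) ++ [ fromℕ n ]
allFin-suc n = trans (tabulate-suc id) (cong (_++ [ fromℕ n ]) (sym (List.map-tabulate id inject₁)))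

allElts-suc : ∀ n → allElts (suc n) ≡ map lift (allElts n) ++ newPos ∷ newNeg ∷ []
allElts-suc n = begin
  concatMap signs (allFin (suc n))                                       ≡⟨ cong (concatMap signs) (allFin-suc n) ⟩
  concatMap signs (map inject₁ (allFin n) ++ [ fromℕ n ])                ≡⟨ List.concatMap-++ signs (map inject₁ (allFin n)) _ ⟩
  concatMap signs (map inject₁ (allFin n)) ++ signs (fromℕ n) ++ []      ≡⟨ cong₂ _++_ (List.concatMap-map signs inject₁ (allFin n)) (List.++-identityʳ _) ⟩
  concatMap (map lift ∘ signs) (allFin n) ++ newPos ∷ newNeg ∷ []        ≡⟨ cong (_++ newPos ∷ newNeg ∷ []) (List.map-concatMap lift signs (allFin n)) ⟨
  map lift (allElts n) ++ newPos ∷ newNeg ∷ []                           ∎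
  where
  open ≡-Reasoning
  signs : ∀ {m} → Fin m → List (Elt m)
  signs i = (false , i) ∷ (true , i) ∷ []

allElts-complete : ∀ {n} (e : Elt n) → e ∈ allElts n
allElts-complete (false , i) = ∈-concatMap-intro _ (here refl) (List∈.∈-allFin i)
allElts-complete (true , i) = ∈-concatMap-intro _ (there (here refl)) (List∈.∈-allFin i)

allElts-unique : ∀ n → Unique (allElts n)
allElts-unique n = Unique-concatMap (All.universal (λ i → ((λ ()) ∷ []) ∷ [] ∷ []) (allFin n))
  (λ i≢j (∈i , ∈j) → i≢j (trans (sym (index ∈i)) (index ∈j))) (Unique.allFin⁺ n)
  where
  index : ∀ {i} {e : Elt n} → e ∈ (false , i) ∷ (true , i) ∷ [] → proj₂ e ≡ i
  index (here refl) = refl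
  index (there (here refl)) = refl

length-allElts : ∀ n → length (allElts n) ≡ 2 * n
length-allElts zero = refl
length-allElts (suc n) = begin
  length (allElts (suc n))                           ≡⟨ cong length (allElts-suc n) ⟩
  length (map lift (allElts n) ++ newPos ∷ newNeg ∷ []) ≡⟨ List.length-++ (map lift (allElts n)) ⟩
  length (map lift (allElts n)) + 2                  ≡⟨ cong (_+ 2) (trans (List.length-map lift (allElts n)) (length-allElts n)) ⟩
  2 * n + 2                                          ≡⟨ ℕ.+-comm (2 * n) 2 ⟩
  2 + 2 * n                                          ≡⟨ ℕ.*-suc 2 n ⟨
  2 * suc n                                          ∎
  where open ≡-Reasoning

data Near {n} (y z : Elt n) : Set where
  at : z ≡ y → Near y z
  atNeg : z ≡ negE y → Near y z
  far : z ≢ y → z ≢ negE y → Near y z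

near : ∀ {n} (y z : Elt n) → Near y z
near y z with z ≟E y | z ≟E negE y
... | yes z≡y | _ = at z≡y
... | no _ | yes z≡-y = atNeg z≡-y
... | no z≢y | no z≢-y = far z≢y z≢-y

near-case : ∀ {n} {y z : Elt n} → Near y z → A → A → A → A
near-case (at _) a _ _ = a
near-case (atNeg _) _ b _ = b
near-case (far _ _) _ _ c = c

near-case-irrelevant : ∀ {n} {y z : Elt n} (p q : Near y z) {a b c : A} → near-case p a b c ≡ near-case q a b c
near-case-irrelevant (at _) (at _) = refl
near-case-irrelevant (atNeg _) (atNeg _) = refl
near-case-irrelevant (far _ _) (far _ _) = refl
near-case-irrelevant {y = y} (at z≡y) (atNeg z≡-y) = ⊥-elim (negE≢self y (trans (sym z≡-y) z≡y))
near-case-irrelevant {y = y} (atNeg z≡-y) (at z≡y) = ⊥-elim (negE≢self y (trans (sym z≡-y) z≡y))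
near-case-irrelevant (at z≡y) (far z≢y _) = ⊥-elim (z≢y z≡y)
near-case-irrelevant (far z≢y _) (at z≡y) = ⊥-elim (z≢y z≡y)
near-case-irrelevant (atNeg z≡-y) (far _ z≢-y) = ⊥-elim (z≢-y z≡-y)
near-case-irrelevant (far _ z≢-y) (atNeg z≡-y) = ⊥-elim (z≢-y z≡-y)

-- Cycles

data Segment (f : A → A) (x : A) : A → List A → Set where
  stop : Segment f x x (x ∷ [])
  step : ∀ {y R} → y ≢ x → Segment f x (f y) R → Segment f x y (y ∷ R)

Segment-functional : ∀ {f : A → A} {x y R R′} →
                     Segment f x y R → Segment f x y R′ → R ≡ R′
Segment-functional stop stop = refl
Segment-functional stop (step x≢x _) = ⊥-elim (x≢x refl)
Segment-functional (step x≢x _) stop = ⊥-elim (x≢x refl)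
Segment-functional (step _ s) (step _ s′) = cong (_ ∷_) (Segment-functional s s′)

Segment-head : ∀ {f : A → A} {x y R} → Segment f x y R → ∃ λ R′ → R ≡ y ∷ R′
Segment-head stop = [] , refl
Segment-head (step {R = R} _ _) = R , refl

Segment-startAt : ∀ {f : A → A} {x y y′ R} → y ≡ y′ → Segment f x y R → Segment f x y′ R
Segment-startAt refl s = s

iterate : (A → A) → ℕ → A → A
iterate f zero a = a
iterate f (suc k) a = iterate f k (f a)

iterate-suc : ∀ (f : A → A) k a → iterate f (suc k) a ≡ f (iterate f k a)
iterate-suc f zero a = refl
iterate-suc f (suc k) a = iterate-suc f k (f a)

iterate-cancel : ∀ {f : A → A} → Injective _≡_ _≡_ f →
                 ∀ i d a → iterate f i a ≡ iterate f (i + d) a → a ≡ iterate f d a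
iterate-cancel f-inj zero d a eq = eq
iterate-cancel {f = f} f-inj (suc i) d a eq = iterate-cancel f-inj i d a (f-inj (begin
  f (iterate f i a)       ≡⟨ iterate-suc f i a ⟨
  iterate f (suc i) a     ≡⟨ eq ⟩
  iterate f (suc i + d) a ≡⟨ iterate-suc f (i + d) a ⟩
  f (iterate f (i + d) a) ∎))
  where open ≡-Reasoning

segment-of-iterate : DecidableEquality A → ∀ (f : A → A) x t y → iterate f t y ≡ x →
                     ∃ λ R → Segment f x y R × length R ≤ suc t
segment-of-iterate _≟A_ f x t y eq with y ≟A x
... | yes refl = _ , stop , s≤s z≤n
segment-of-iterate _≟A_ f x zero y eq | no y≢x = ⊥-elim (y≢x eq)
segment-of-iterate _≟A_ f x (suc t) y eq | no y≢x with segment-of-iterate _≟A_ f x t (f y) eq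
... | R , s , len≤ = _ , step y≢x s , s≤s len≤

private
  bool↣fin : Bool ↣ Fin 2
  bool↣fin = ↔⇒↣ (↔-sym Fin.2↔Bool)

  encode : ∀ {n} → Elt n → Fin (2 * n)
  encode (s , i) = combine (Injection.to bool↣fin s) i

  encode-injective : ∀ {n} → Injective _≡_ _≡_ (encode {n})
  encode-injective {x = s , i} {t , j} eq with Fin.combine-injective _ i _ j eq
  ... | s≡t , refl = cong (_, i) (Injection.injective bool↣fin s≡t)

-- The 2n + 1 points fˡ(f x), l ≤ 2n, cannot all be distinct, so the orbit
-- of x returns to x within 2n steps.
segment-closes : ∀ {n} {f : Elt n → Elt n} → Injective _≡_ _≡_ f → ∀ x →
                 ∃ λ R → Segment f x (f x) R × length R ≤ 2 * n
segment-closes {n} {f} f-inj x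
  with Fin.pigeonhole (ℕ.n<1+n (2 * n)) (λ l → encode (iterate f (toℕ l) (f x)))
... | i , j , i<j , same with ℕ.m≤n⇒∃[o]m+o≡n i<j
... | d , i+1+d≡j =
  map₂ (map₂ (λ len≤ → ℕ.≤-trans len≤ steps≤)) (segment-of-iterate _≟E_ f x d (f x) reaches)
  where
  open ≡-Reasoning
  i+d+1≡j : toℕ i + suc d ≡ toℕ j
  i+d+1≡j = trans (ℕ.+-suc (toℕ i) d) i+1+d≡j
  steps≤ : suc d ≤ 2 * n
  steps≤ = ℕ.≤-trans (ℕ.m≤n+m (suc d) (toℕ i)) (subst (_≤ 2 * n) (sym i+d+1≡j) (ℕ.≤-pred (Fin.toℕ<n j)))
  returns : iterate f (toℕ i) (f x) ≡ iterate f (toℕ i + suc d) (f x)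
  returns = begin
    iterate f (toℕ i) (f x)           ≡⟨ encode-injective same ⟩
    iterate f (toℕ j) (f x)           ≡⟨ cong (λ m → iterate f m (f x)) i+d+1≡j ⟨
    iterate f (toℕ i + suc d) (f x)   ∎
  reaches : iterate f d (f x) ≡ x
  reaches = f-inj (sym (trans (iterate-cancel f-inj (toℕ i) (suc d) (f x) returns) (iterate-suc f d (f x))))

-- The helper of cycleEnding is bound in an anonymous where block; this record
-- recovers it, and its defining equations, by unification.
record CycleEndingUnfolding {n} (v : SVec n) (x : Elt n) : Set where
  field
    go : ℕ → Elt n → List (Elt n)
    go-zero : ∀ y → go 0 y ≡ x ∷ []
    go-suc : ∀ f y → go (suc f) y ≡ (if eqE y x then x ∷ [] else y ∷ go f (apply v y))
    unfold : cycleEnding v x ≡ go (2 * n) (apply v x)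

cycleEnding-unfolding : ∀ {n} (v : SVec n) x → CycleEndingUnfolding v x
cycleEnding-unfolding {n} v x =
  record { go = go ; go-zero = λ _ → refl ; go-suc = λ _ _ → refl ; unfold = unfold }
  where
  go : ℕ → Elt n → List (Elt n)
  go = _
  unfold : cycleEnding v x ≡ go (2 * n) (apply v x)
  unfold with 2 * n | apply v x
  ... | fuel | y = refl

module _ {n} {v : SVec n} {x : Elt n} (u : CycleEndingUnfolding v x) where
  open CycleEndingUnfolding u

  go-segment : ∀ {y R} → Segment (apply v) x y R → ∀ fuel → length R ≤ suc fuel → go fuel y ≡ R
  go-segment stop zero _ = go-zero x
  go-segment stop (suc fuel) _ rewrite go-suc fuel x | eqE-refl x = refl
  go-segment (step _ s) zero (s≤s len≤) with Segment-head s
  ... | _ , refl with len≤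
  ... | ()
  go-segment (step {y} y≢x s) (suc fuel) (s≤s len≤) rewrite go-suc fuel y | eqE-≢ y≢x =
    cong (y ∷_) (go-segment s fuel len≤)

cycleEnding-segment : ∀ {n} {v : SVec n} → Injective _≡_ _≡_ (apply v) →
                      ∀ {x R} → Segment (apply v) x (apply v x) R → cycleEnding v x ≡ R
cycleEnding-segment {n} {v} inj {x} {R} s with segment-closes inj x
... | R₀ , s₀ , len≤ = begin
  cycleEnding v x           ≡⟨ unfold ⟩
  go (2 * n) (apply v x)    ≡⟨ go-segment u s₀ (2 * n) (ℕ.m≤n⇒m≤1+n len≤) ⟩
  R₀                        ≡⟨ Segment-functional s₀ s ⟩
  R                         ∎
  where
  open ≡-Reasoning
  u : CycleEndingUnfolding v x
  u = cycleEnding-unfolding v x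
  open CycleEndingUnfolding u

record IsSignedPerm {n} (v : SVec n) : Set where
  constructor signedPerm
  field absInjective : Injective _≡_ _≡_ (proj₂ ∘ lookup v)
open IsSignedPerm

proj₂-apply : ∀ {n} (v : SVec n) s i → proj₂ (apply v (s , i)) ≡ proj₂ (lookup v i)
proj₂-apply v false i = refl
proj₂-apply v true i = refl

apply-injective : ∀ {n} {v : SVec n} → IsSignedPerm v → Injective _≡_ _≡_ (apply v)
apply-injective {v = v} v-perm {s , i} {t , j} eq
  with absInjective v-perm (trans (sym (proj₂-apply v s i)) (trans (cong proj₂ eq) (proj₂-apply v t j)))
... | refl with s | t
...   | false | false = refl
...   | true | true = refl
...   | false | true = ⊥-elim (negE≢self (lookup v i) (sym eq))
...   | true | false = ⊥-elim (negE≢self (lookup v i) eq)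

cycleEnding-head : ∀ {n} {v : SVec n} → IsSignedPerm v → ∀ x → ∃ λ R → cycleEnding v x ≡ apply v x ∷ R
cycleEnding-head v-perm x with segment-closes (apply-injective v-perm) x
... | R , s , _ with Segment-head s
... | R′ , refl = R′ , cycleEnding-segment (apply-injective v-perm) s

cycleEnding-startAt : ∀ {n} {v : SVec n} → IsSignedPerm v → ∀ {x y R} → apply v x ≡ y →
                      Segment (apply v) x y R → cycleEnding v x ≡ R
cycleEnding-startAt v-perm eq s = cycleEnding-segment (apply-injective v-perm) (Segment-startAt (sym eq) s)

absValues : ∀ {n} → SVec n → List (Fin n)
absValues v = map proj₂ (toList v)

absValues-tabulate : ∀ {n} (v : SVec n) → absValues v ≡ List.tabulate (proj₂ ∘ lookup v)
absValues-tabulate v = trans (cong (map proj₂) (toList-tabulate-lookup v)) (List.map-tabulate (lookup v) proj₂)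

allVecs-complete : ∀ (xs : List A) {m} (u : Vec A m) → (∀ k → lookup u k ∈ xs) → u ∈ allVecs xs m
allVecs-complete xs Vec.[] _ = here refl
allVecs-complete xs (a Vec.∷ u) entries∈ =
  ∈-concatMap-intro (λ x → map (x Vec.∷_) (allVecs xs _))
    (List∈.∈-map⁺ (a Vec.∷_) (allVecs-complete xs u (entries∈ ∘ Fin.suc))) (entries∈ Fin.zero)

allVecs-unique : ∀ {xs : List A} → Unique xs → ∀ m → Unique (allVecs xs m)
allVecs-unique u zero = [] ∷ []
allVecs-unique {xs = xs} u (suc m) =
  Unique-concatMap (All.universal (λ x → Unique.map⁺ Vec.∷-injectiveʳ (allVecs-unique u m)) xs)
    (λ x≢x′ (∈x , ∈x′) → x≢x′ (trans (sym (head≡ ∈x)) (head≡ ∈x′))) u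
  where
  head≡ : ∀ {x u} → u ∈ map (x Vec.∷_) (allVecs xs m) → Vec.head u ≡ x
  head≡ {x} u∈ with List∈.∈-map⁻ (x Vec.∷_) u∈
  ... | _ , _ , u≡ = cong Vec.head u≡

signedPerms-sound : ∀ {n} {v : SVec n} → v ∈ signedPerms n → IsSignedPerm v
signedPerms-sound {n} {v} v∈ = signedPerm $
  Unique-tabulate⁻ (subst Unique (absValues-tabulate v)
    (proj₂ (List∈.∈-filter⁻ (λ u → UniqFin.unique? (absValues u)) {xs = allVecs (allElts n) n} v∈)))

signedPerms-complete : ∀ {n} {v : SVec n} → IsSignedPerm v → v ∈ signedPerms n
signedPerms-complete {n} {v} v-perm =
  List∈.∈-filter⁺ (λ u → UniqFin.unique? (absValues u)) (allVecs-complete (allElts n) v (λ _ → allElts-complete _))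
    (subst Unique (sym (absValues-tabulate v)) (Unique.tabulate⁺ (absInjective v-perm)))

signedPerms-unique : ∀ n → Unique (signedPerms n)
signedPerms-unique n = Unique.filter⁺ (λ u → UniqFin.unique? (absValues u)) (allVecs-unique (allElts-unique n) n)

-- Inserting n+1

-- fixedPair: the cycles (n+1)(-n-1); unpairedPair: the cycle (n+1,-n-1);
-- before y: n+1 just before y and -n-1 just before -y.
data Choice (n : ℕ) : Set where
  fixedPair unpairedPair : Choice n
  before : Elt n → Choice n

redirect : ∀ {n} → Elt n → Elt n → Elt (suc n)
redirect y z = near-case (near y z) newPos newNeg (lift z)

relabel : ∀ {n} → Choice n → Elt n → Elt (suc n)
relabel fixedPair = lift
relabel unpairedPair = lift
relabel (before y) = redirect y

newImage : ∀ {n} → Choice n → Elt (suc n)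
newImage fixedPair = newPos
newImage unpairedPair = newNeg
newImage (before y) = lift y

extend : ∀ {n} → SVec n → Choice n → SVec (suc n)
extend v c = Vec.map (relabel c) v ∷ʳ newImage c

redirect-at : ∀ {n} {y z : Elt n} → z ≡ y → redirect y z ≡ newPos
redirect-at {y = y} {z} z≡y = near-case-irrelevant (near y z) (at z≡y)

redirect-atNeg : ∀ {n} {y z : Elt n} → z ≡ negE y → redirect y z ≡ newNeg
redirect-atNeg {y = y} {z} z≡-y = near-case-irrelevant (near y z) (atNeg z≡-y)

redirect-far : ∀ {n} {y z : Elt n} → z ≢ y → z ≢ negE y → redirect y z ≡ lift z
redirect-far {y = y} {z} z≢y z≢-y = near-case-irrelevant (near y z) (far z≢y z≢-y)

redirect-negE : ∀ {n} (y z : Elt n) → redirect y (negE z) ≡ negE (redirect y z)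
redirect-negE y z with near y z
... | at refl = redirect-atNeg refl
... | atNeg refl = redirect-at (negE-involutive y)
... | far z≢y z≢-y = trans
  (redirect-far (λ eq → z≢-y (trans (sym (negE-involutive z)) (cong negE eq)))
                (z≢y ∘ negE-injective))
  (lift-negE z)

relabel-negE : ∀ {n} (c : Choice n) z → relabel c (negE z) ≡ negE (relabel c z)
relabel-negE fixedPair = lift-negE
relabel-negE unpairedPair = lift-negE
relabel-negE (before y) = redirect-negE y

redirect-injective : ∀ {n} (y : Elt n) → Injective _≡_ _≡_ (redirect y)
redirect-injective y {a} {b} eq with near y a | near y b
... | at refl | at refl = refl
... | atNeg refl | atNeg refl = refl
... | far _ _ | far _ _ = lift-injective eq
... | at _ | atNeg _ = case eq of λ ()
... | atNeg _ | at _ = case eq of λ ()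
... | at _ | far _ _ = ⊥-elim (lift≢new b false (sym eq))
... | atNeg _ | far _ _ = ⊥-elim (lift≢new b true (sym eq))
... | far _ _ | at _ = ⊥-elim (lift≢new a false eq)
... | far _ _ | atNeg _ = ⊥-elim (lift≢new a true eq)

relabel-injective : ∀ {n} (c : Choice n) → Injective _≡_ _≡_ (relabel c)
relabel-injective fixedPair = lift-injective
relabel-injective unpairedPair = lift-injective
relabel-injective (before y) = redirect-injective y

relabel-sameAbs : ∀ {n} (c : Choice n) (a b : Elt n) →
                  proj₂ a ≡ proj₂ b → proj₂ (relabel c a) ≡ proj₂ (relabel c b)
relabel-sameAbs c a b eq with sameAbs⇒≡⊎≡negE a b eq
... | inj₁ refl = refl
... | inj₂ refl = cong proj₂ (relabel-negE c b)

relabel-sameAbs⁻ : ∀ {n} (c : Choice n) (a b : Elt n) →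
                   proj₂ (relabel c a) ≡ proj₂ (relabel c b) → proj₂ a ≡ proj₂ b
relabel-sameAbs⁻ c a b eq with sameAbs⇒≡⊎≡negE (relabel c a) (relabel c b) eq
... | inj₁ same = cong proj₂ (relabel-injective c same)
... | inj₂ opp = cong proj₂ (relabel-injective c (trans opp (sym (relabel-negE c b))))

newImage-apart : ∀ {n} (c : Choice n) z → proj₂ (newImage c) ≢ proj₂ (relabel c z)
newImage-apart fixedPair z = Fin.fromℕ≢inject₁
newImage-apart unpairedPair z = Fin.fromℕ≢inject₁
newImage-apart (before y) z eq with near y z
... | at _ = Fin.fromℕ≢inject₁ (sym eq)
... | atNeg _ = Fin.fromℕ≢inject₁ (sym eq)
... | far z≢y z≢-y with sameAbs⇒≡⊎≡negE z y (sym (Fin.inject₁-injective eq))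
...   | inj₁ z≡y = z≢y z≡y
...   | inj₂ z≡-y = z≢-y z≡-y

module _ {n} (v : SVec n) (c : Choice n) where

  lookup-extend-last : lookup (extend v c) (fromℕ n) ≡ newImage c
  lookup-extend-last = lookup-∷ʳ-last (Vec.map (relabel c) v) (newImage c)

  lookup-extend-inject₁ : ∀ i → lookup (extend v c) (inject₁ i) ≡ relabel c (lookup v i)
  lookup-extend-inject₁ i = trans (lookup-∷ʳ-inject₁ (Vec.map (relabel c) v) (newImage c) i) (Vec.lookup-map i (relabel c) v)

  apply-extend-lift : ∀ z → apply (extend v c) (lift z) ≡ relabel c (apply v z)
  apply-extend-lift (false , i) = lookup-extend-inject₁ i
  apply-extend-lift (true , i) =
    trans (cong negE (lookup-extend-inject₁ i)) (sym (relabel-negE c (lookup v i)))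

  apply-extend-newPos : apply (extend v c) newPos ≡ newImage c
  apply-extend-newPos = lookup-extend-last

  apply-extend-newNeg : apply (extend v c) newNeg ≡ negE (newImage c)
  apply-extend-newNeg = cong negE lookup-extend-last

extend-isSignedPerm : ∀ {n} {v : SVec n} c → IsSignedPerm v → IsSignedPerm (extend v c)
extend-isSignedPerm {n} {v} c v-perm = signedPerm absInjective′
  where
  absInjective′ : Injective _≡_ _≡_ (proj₂ ∘ lookup (extend v c))
  absInjective′ {j} {j′} eq with Top.view j | Top.view j′
  ... | Top.‵fromℕ | Top.‵fromℕ = refl
  ... | Top.‵fromℕ | Top.‵inject₁ i′ = ⊥-elim (newImage-apart c (lookup v i′)
        (trans (cong proj₂ (sym (lookup-extend-last v c))) (trans eq (cong proj₂ (lookup-extend-inject₁ v c i′)))))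
  ... | Top.‵inject₁ i | Top.‵fromℕ = ⊥-elim (newImage-apart c (lookup v i)
        (trans (cong proj₂ (sym (lookup-extend-last v c))) (trans (sym eq) (cong proj₂ (lookup-extend-inject₁ v c i)))))
  ... | Top.‵inject₁ i | Top.‵inject₁ i′ = cong inject₁ (absInjective v-perm (relabel-sameAbs⁻ c _ _
        (trans (cong proj₂ (sym (lookup-extend-inject₁ v c i))) (trans eq (cong proj₂ (lookup-extend-inject₁ v c i′))))))

newImage-injective : ∀ {n} → Injective _≡_ _≡_ (newImage {n})
newImage-injective {x = fixedPair} {fixedPair} _ = refl
newImage-injective {x = unpairedPair} {unpairedPair} _ = refl
newImage-injective {x = before y} {before y′} eq = cong before (lift-injective eq)
newImage-injective {x = fixedPair} {unpairedPair} ()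
newImage-injective {x = unpairedPair} {fixedPair} ()
newImage-injective {x = fixedPair} {before y} eq = ⊥-elim (lift≢new y false (sym eq))
newImage-injective {x = unpairedPair} {before y} eq = ⊥-elim (lift≢new y true (sym eq))
newImage-injective {x = before y} {fixedPair} eq = ⊥-elim (lift≢new y false eq)
newImage-injective {x = before y} {unpairedPair} eq = ⊥-elim (lift≢new y true eq)

newImage-surjective : ∀ {n} (t : Elt (suc n)) → ∃ λ c → newImage c ≡ t
newImage-surjective t with eltView t
... | new false = fixedPair , refl
... | new true = unpairedPair , refl
... | lifted y = before y , refl

relabel-surjective : ∀ {n} (c : Choice n) u → proj₂ u ≢ proj₂ (newImage c) → ∃ λ z → relabel c z ≡ u
relabel-surjective c u apart with eltView u
relabel-surjective fixedPair _ apart | new s = ⊥-elim (apart refl)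
relabel-surjective unpairedPair _ apart | new s = ⊥-elim (apart refl)
relabel-surjective (before y) _ apart | new false = y , redirect-at refl
relabel-surjective (before y) _ apart | new true = negE y , redirect-atNeg refl
relabel-surjective fixedPair _ apart | lifted a = a , refl
relabel-surjective unpairedPair _ apart | lifted a = a , refl
relabel-surjective (before y) _ apart | lifted a =
  a , redirect-far (λ a≡y → apart (cong (inject₁ ∘ proj₂) a≡y))
                   (λ a≡-y → apart (cong (inject₁ ∘ proj₂) a≡-y))

extend-injective : ∀ {n} {v v′ : SVec n} {c c′} → extend v c ≡ extend v′ c′ → v ≡ v′ × c ≡ c′
extend-injective {v = v} {v′} {c} {c′} eq with Vec.∷ʳ-injective (Vec.map (relabel c) v) (Vec.map (relabel c′) v′) eq
... | maps≡ , images≡ with newImage-injective images≡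
... | refl = Vec-map-injective (relabel-injective c) maps≡ , refl

extend-surjective : ∀ {n} (v : SVec (suc n)) → IsSignedPerm v →
                    ∃ λ v′ → ∃ λ c → IsSignedPerm v′ × extend v′ c ≡ v
extend-surjective {n} v v-perm with Vec.initLast v
... | ys , t , refl with newImage-surjective t
... | c , refl = v′ , c , v′-perm , cong (_∷ʳ newImage c) relabelled
  where
  open ≡-Reasoning
  lookup-old : ∀ i → lookup (ys ∷ʳ newImage c) (inject₁ i) ≡ lookup ys i
  lookup-old = lookup-∷ʳ-inject₁ ys (newImage c)
  apart : ∀ i → proj₂ (lookup ys i) ≢ proj₂ (newImage c)
  apart i eq = Fin.fromℕ≢inject₁ (sym (absInjective v-perm (trans (cong proj₂ (lookup-old i))
                 (trans eq (cong proj₂ (sym (lookup-∷ʳ-last ys (newImage c))))))))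
  preimage : ∀ i → ∃ λ z → relabel c z ≡ lookup ys i
  preimage i = relabel-surjective c (lookup ys i) (apart i)
  v′ : SVec n
  v′ = tabulate (proj₁ ∘ preimage)
  relabelled : Vec.map (relabel c) v′ ≡ ys
  relabelled = begin
    Vec.map (relabel c) v′                 ≡⟨ Vec.tabulate-∘ (relabel c) (proj₁ ∘ preimage) ⟨
    tabulate (relabel c ∘ proj₁ ∘ preimage) ≡⟨ Vec.tabulate-cong (proj₂ ∘ preimage) ⟩
    tabulate (lookup ys)                   ≡⟨ Vec.tabulate∘lookup ys ⟩
    ys                                     ∎
  v′-perm : IsSignedPerm v′
  v′-perm = signedPerm absInjective′
    where
    absInjective′ : Injective _≡_ _≡_ (proj₂ ∘ lookup v′)
    absInjective′ {i} {j} eq = Fin.inject₁-injective (absInjective v-perm (begin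
      proj₂ (lookup (ys ∷ʳ newImage c) (inject₁ i))          ≡⟨ cong proj₂ (lookup-old i) ⟩
      proj₂ (lookup ys i)                                      ≡⟨ cong proj₂ (proj₂ (preimage i)) ⟨
      proj₂ (relabel c (proj₁ (preimage i)))                   ≡⟨ relabel-sameAbs c _ _ same ⟩
      proj₂ (relabel c (proj₁ (preimage j)))                   ≡⟨ cong proj₂ (proj₂ (preimage j)) ⟩
      proj₂ (lookup ys j)                                      ≡⟨ cong proj₂ (lookup-old j) ⟨
      proj₂ (lookup (ys ∷ʳ newImage c) (inject₁ j))          ∎))
      where
      same : proj₂ (proj₁ (preimage i)) ≡ proj₂ (proj₁ (preimage j))
      same = trans (cong proj₂ (sym (Vec.lookup∘tabulate (proj₁ ∘ preimage) i)))
                   (trans eq (cong proj₂ (Vec.lookup∘tabulate (proj₁ ∘ preimage) j)))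

block : ∀ {n} → Choice n → Elt n → List (Elt (suc n))
block fixedPair z = lift z ∷ []
block unpairedPair z = lift z ∷ []
block (before y) z = near-case (near y z) (newPos ∷ lift z ∷ []) (newNeg ∷ lift z ∷ []) (lift z ∷ [])

block-at : ∀ {n} {y z : Elt n} → z ≡ y → block (before y) z ≡ newPos ∷ lift z ∷ []
block-at {y = y} {z} z≡y = near-case-irrelevant (near y z) (at z≡y)

block-atNeg : ∀ {n} {y z : Elt n} → z ≡ negE y → block (before y) z ≡ newNeg ∷ lift z ∷ []
block-atNeg {y = y} {z} z≡-y = near-case-irrelevant (near y z) (atNeg z≡-y)

block-far : ∀ {n} {y z : Elt n} → z ≢ y → z ≢ negE y → block (before y) z ≡ lift z ∷ []
block-far {y = y} {z} z≢y z≢-y = near-case-irrelevant (near y z) (far z≢y z≢-y)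

insertNew : ∀ {n} → Choice n → List (Elt n) → List (Elt (suc n))
insertNew c = concatMap (block c)

insertNew-concatMap : ∀ {n} (c : Choice n) (g : A → List (Elt n)) xs →
                      concatMap (insertNew c ∘ g) xs ≡ insertNew c (concatMap g xs)
insertNew-concatMap c g [] = refl
insertNew-concatMap c g (x ∷ xs) =
  trans (cong (insertNew c (g x) ++_) (insertNew-concatMap c g xs)) (sym (List.concatMap-++ (block c) (g x) _))

segment-block : ∀ {n} (v : SVec n) c {t r X} →
                Segment (apply (extend v c)) (lift t) (lift r) (lift r ∷ X) →
                Segment (apply (extend v c)) (lift t) (relabel c r) (block c r ++ X)
segment-block v fixedPair s = s
segment-block v unpairedPair s = s
segment-block v (before y) {t} {r} s with near y r
... | at refl = step (λ eq → lift≢new t false (sym eq))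
                (Segment-startAt (sym (apply-extend-newPos v (before y))) s)
... | atNeg refl = step (λ eq → lift≢new t true (sym eq))
                   (Segment-startAt (sym (apply-extend-newNeg v (before y))) s)
... | far _ _ = s

segment-insertNew : ∀ {n} (v : SVec n) c {t a R} → Segment (apply v) t a R →
                    Segment (apply (extend v c)) (lift t) (relabel c a) (insertNew c R)
segment-insertNew v c stop = segment-block v c stop
segment-insertNew v c {t} {a} (step a≢t s) =
  segment-block v c (step (a≢t ∘ lift-injective)
    (Segment-startAt (sym (apply-extend-lift v c a)) (segment-insertNew v c s)))

cycleEnding-extend-lift : ∀ {n} {v : SVec n} c → IsSignedPerm v →
                          ∀ z → cycleEnding (extend v c) (lift z) ≡ insertNew c (cycleEnding v z)
cycleEnding-extend-lift {v = v} c v-perm z with segment-closes (apply-injective v-perm) z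
... | R , s , _ = trans
  (cycleEnding-segment (apply-injective (extend-isSignedPerm c v-perm))
    (Segment-startAt (sym (apply-extend-lift v c z)) (segment-insertNew v c s)))
  (cong (insertNew c) (sym (cycleEnding-segment (apply-injective v-perm) s)))

data Lifted {n} : List (Elt (suc n)) → List (Elt n) → Set where
  [] : Lifted [] []
  old : ∀ {xs ys} y → Lifted xs ys → Lifted (lift y ∷ xs) (y ∷ ys)
  new : ∀ {xs ys} s → Lifted xs ys → Lifted ((s , fromℕ n) ∷ xs) ys

Lifted-block : ∀ {n} (c : Choice n) z {xs ys} → Lifted xs ys → Lifted (block c z ++ xs) (z ∷ ys)
Lifted-block fixedPair z l = old z l
Lifted-block unpairedPair z l = old z l
Lifted-block (before y) z l with near y z
... | at _ = new false (old z l)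
... | atNeg _ = new true (old z l)
... | far _ _ = old z l

Lifted-insertNew : ∀ {n} (c : Choice n) zs → Lifted (insertNew c zs) zs
Lifted-insertNew c [] = []
Lifted-insertNew c (z ∷ zs) = Lifted-block c z (Lifted-insertNew c zs)

Lifted-++-new : ∀ {n} {xs ys} s t → Lifted {n} xs ys → Lifted (xs ++ (s , fromℕ n) ∷ (t , fromℕ n) ∷ []) ys
Lifted-++-new s t [] = new s (new t [])
Lifted-++-new s t (old y l) = old y (Lifted-++-new s t l)
Lifted-++-new s t (new s′ l) = new s′ (Lifted-++-new s t l)

all-Lifted : ∀ {n} {xs ys} Q → (∀ s → Q (s , fromℕ n) ≡ true) → Lifted xs ys → all Q xs ≡ all (Q ∘ lift) ys
all-Lifted Q Q-new [] = refl
all-Lifted Q Q-new (old y l) = cong (Q (lift y) ∧_) (all-Lifted Q Q-new l)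
all-Lifted Q Q-new (new {xs} s l) = trans (cong (_∧ all Q xs) (Q-new s)) (all-Lifted Q Q-new l)

any-Lifted : ∀ {n} {xs ys} Q → (∀ s → Q (s , fromℕ n) ≡ false) → Lifted xs ys → any Q xs ≡ any (Q ∘ lift) ys
any-Lifted Q Q-new [] = refl
any-Lifted Q Q-new (old y l) = cong (Q (lift y) ∨_) (any-Lifted Q Q-new l)
any-Lifted Q Q-new (new {xs} s l) = trans (cong (_∨ any Q xs) (Q-new s)) (any-Lifted Q Q-new l)

∑-Lifted : ∀ {n} {xs ys} f → (∀ s → f (s , fromℕ n) ≡ 0) → Lifted xs ys → ∑ f xs ≡ ∑ (f ∘ lift) ys
∑-Lifted f f-new [] = refl
∑-Lifted f f-new (old y l) = cong (f (lift y) +_) (∑-Lifted f f-new l)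
∑-Lifted f f-new (new s l) = cong₂ _+_ (f-new s) (∑-Lifted f f-new l)

module _ {n} {v : SVec n} (c : Choice n) (v-perm : IsSignedPerm v) where

  private
    w : SVec (suc n)
    w = extend v c

  isCycleMin-extend-lift : ∀ z → isCycleMin w (lift z) ≡ isCycleMin v z
  isCycleMin-extend-lift z = begin
    all Q (cycleEnding w (lift z))               ≡⟨ cong (all Q) (cycleEnding-extend-lift c v-perm z) ⟩
    all Q (insertNew c (cycleEnding v z))        ≡⟨ all-Lifted Q Q-new (Lifted-insertNew c (cycleEnding v z)) ⟩
    all (Q ∘ lift) (cycleEnding v z)             ≡⟨ cong and (List.map-cong (λ y → cong₂ _≤ᵇ_ (absE-lift z) (absE-lift y)) (cycleEnding v z)) ⟩
    isCycleMin v z                               ∎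
    where
    open ≡-Reasoning
    Q : Elt (suc n) → Bool
    Q y = absE (lift z) ≤ᵇ absE y
    Q-new : ∀ s → Q (s , fromℕ n) ≡ true
    Q-new s = ≤ᵇ-true (subst₂ _≤_ (sym (absE-lift z)) (sym (absE-new s)) (ℕ.<⇒≤ (absE<n z)))

  unpairedAt-extend-lift : ∀ z → unpairedAt w (lift z) ≡ unpairedAt v z
  unpairedAt-extend-lift z = begin
    any Q (cycleEnding w (lift z))               ≡⟨ cong (any Q) (cycleEnding-extend-lift c v-perm z) ⟩
    any Q (insertNew c (cycleEnding v z))        ≡⟨ any-Lifted Q (λ s → eqE-≢ (lift≢new (negE z) s)) (Lifted-insertNew c (cycleEnding v z)) ⟩
    any (Q ∘ lift) (cycleEnding v z)             ≡⟨ cong or (List.map-cong (eqE-lift (negE z)) (cycleEnding v z)) ⟩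
    unpairedAt v z                               ∎
    where
    open ≡-Reasoning
    Q : Elt (suc n) → Bool
    Q = eqE (lift (negE z))

cycleBlock : Bool → Bool → List A → List A → List A
cycleBlock isMin unpaired neg pos = if isMin then (if unpaired then neg else neg ++ pos) else []

wordBlock : ∀ {n} → SVec n → Fin n → List (Elt n)
wordBlock v m = cycleBlock (isCycleMin v (false , m)) (unpairedAt v (false , m))
                           (cycleEnding v (true , m)) (cycleEnding v (false , m))

standardWord-blocks : ∀ {n} (v : SVec n) → standardWord v ≡ concatMap (wordBlock v) (allFin n)
standardWord-blocks v = refl

cycleBlock-insertNew : ∀ {n} (c : Choice n) isMin unpaired neg pos →
  cycleBlock isMin unpaired (insertNew c neg) (insertNew c pos) ≡ insertNew c (cycleBlock isMin unpaired neg pos)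
cycleBlock-insertNew c false _ neg pos = refl
cycleBlock-insertNew c true true neg pos = refl
cycleBlock-insertNew c true false neg pos = sym (List.concatMap-++ (block c) neg pos)

wordBlock-extend-inject₁ : ∀ {n} {v : SVec n} c → IsSignedPerm v →
                           ∀ i → wordBlock (extend v c) (inject₁ i) ≡ insertNew c (wordBlock v i)
wordBlock-extend-inject₁ {n} {v} c v-perm i = begin
  wordBlock w (inject₁ i)
    ≡⟨ cong₂ (λ isMin unpaired → cycleBlock isMin unpaired (cycleEnding w (true , inject₁ i)) (cycleEnding w (false , inject₁ i)))
             (isCycleMin-extend-lift c v-perm (false , i)) (unpairedAt-extend-lift c v-perm (false , i)) ⟩
  cycleBlock isMin unpaired (cycleEnding w (true , inject₁ i)) (cycleEnding w (false , inject₁ i))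
    ≡⟨ cong₂ (cycleBlock isMin unpaired) (cycleEnding-extend-lift c v-perm (true , i)) (cycleEnding-extend-lift c v-perm (false , i)) ⟩
  cycleBlock isMin unpaired (insertNew c (cycleEnding v (true , i))) (insertNew c (cycleEnding v (false , i)))
    ≡⟨ cycleBlock-insertNew c isMin unpaired (cycleEnding v (true , i)) (cycleEnding v (false , i)) ⟩
  insertNew c (wordBlock v i) ∎
  where
  open ≡-Reasoning
  w : SVec (suc n)
  w = extend v c
  isMin unpaired : Bool
  isMin = isCycleMin v (false , i)
  unpaired = unpairedAt v (false , i)

bonus : ∀ {n} → Choice n → ℕ
bonus fixedPair = 2
bonus unpairedPair = 0
bonus (before _) = 0

newCycleWord : ∀ {n} → Choice n → List (Elt (suc n))
newCycleWord fixedPair = newNeg ∷ newPos ∷ []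
newCycleWord unpairedPair = newPos ∷ newNeg ∷ []
newCycleWord (before _) = []

isPairedMin : ∀ {n} → SVec n → Elt n → Bool
isPairedMin v x = isCycleMin v x ∧ not (unpairedAt v x)

module _ {n} {u : SVec n} {x : Elt n} where

  isCycleMin-singleton : cycleEnding u x ≡ x ∷ [] → isCycleMin u x ≡ true
  isCycleMin-singleton eq = trans (cong (all (λ y → absE x ≤ᵇ absE y)) eq) (cong (_∧ true) (≤ᵇ-refl (absE x)))

  unpairedAt-singleton : cycleEnding u x ≡ x ∷ [] → unpairedAt u x ≡ false
  unpairedAt-singleton eq = trans (cong (any (eqE (negE x))) eq) (cong (_∨ false) (eqE-≢ (negE≢self x)))

  isPairedMin-singleton : cycleEnding u x ≡ x ∷ [] → isPairedMin u x ≡ true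
  isPairedMin-singleton eq = cong₂ (λ a b → a ∧ not b) (isCycleMin-singleton eq) (unpairedAt-singleton eq)

  isCycleMin-2cycle : cycleEnding u x ≡ negE x ∷ x ∷ [] → isCycleMin u x ≡ true
  isCycleMin-2cycle eq = trans (cong (all (λ y → absE x ≤ᵇ absE y)) eq)
                               (cong₂ (λ a b → a ∧ b ∧ true) (≤ᵇ-refl (absE x)) (≤ᵇ-refl (absE x)))

  unpairedAt-2cycle : cycleEnding u x ≡ negE x ∷ x ∷ [] → unpairedAt u x ≡ true
  unpairedAt-2cycle eq = trans (cong (any (eqE (negE x))) eq) (cong (_∨ any (eqE (negE x)) (x ∷ [])) (eqE-refl (negE x)))

  isPairedMin-unpaired : cycleEnding u x ≡ negE x ∷ x ∷ [] → isPairedMin u x ≡ false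
  isPairedMin-unpaired eq = trans (cong (λ b → isCycleMin u x ∧ not b) (unpairedAt-2cycle eq)) (∧-zeroʳ _)

module _ {n} {v : SVec n} (v-perm : IsSignedPerm v) where

  private
    perm : ∀ c → IsSignedPerm (extend v c)
    perm c = extend-isSignedPerm c v-perm

  cycleEnding-fixedPair : ∀ s → cycleEnding (extend v fixedPair) (s , fromℕ n) ≡ (s , fromℕ n) ∷ []
  cycleEnding-fixedPair false = cycleEnding-startAt (perm fixedPair) (apply-extend-newPos v fixedPair) stop
  cycleEnding-fixedPair true = cycleEnding-startAt (perm fixedPair) (apply-extend-newNeg v fixedPair) stop

  cycleEnding-unpairedPair : ∀ s → cycleEnding (extend v unpairedPair) (s , fromℕ n) ≡ (not s , fromℕ n) ∷ (s , fromℕ n) ∷ []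
  cycleEnding-unpairedPair false = cycleEnding-startAt (perm unpairedPair) (apply-extend-newPos v unpairedPair)
    (step (λ ()) (Segment-startAt (sym (apply-extend-newNeg v unpairedPair)) stop))
  cycleEnding-unpairedPair true = cycleEnding-startAt (perm unpairedPair) (apply-extend-newNeg v unpairedPair)
    (step (λ ()) (Segment-startAt (sym (apply-extend-newPos v unpairedPair)) stop))

  isCycleMin-before-new : ∀ y s → isCycleMin (extend v (before y)) (s , fromℕ n) ≡ false
  isCycleMin-before-new y s =
    trans (cong (all Q) (proj₂ head)) (cong (_∧ all Q (proj₁ head)) (≤ᵇ-false (first<new s)))
    where
    head : ∃ λ R → cycleEnding (extend v (before y)) (s , fromℕ n) ≡ apply (extend v (before y)) (s , fromℕ n) ∷ R
    head = cycleEnding-head (perm (before y)) (s , fromℕ n)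
    Q : Elt (suc n) → Bool
    Q z = absE {suc n} (s , fromℕ n) ≤ᵇ absE z
    absE-first : ∀ s → absE (apply (extend v (before y)) (s , fromℕ n)) ≡ absE y
    absE-first false = trans (cong absE (apply-extend-newPos v (before y))) (absE-lift y)
    absE-first true = trans (cong absE (apply-extend-newNeg v (before y))) (absE-lift y)
    first<new : ∀ s → absE (apply (extend v (before y)) (s , fromℕ n)) < absE {suc n} (s , fromℕ n)
    first<new s = subst₂ _<_ (sym (absE-first s)) (sym (absE-new s)) (absE<n y)

  ∑-isPairedMin-new : ∀ c → ∑ (𝟙 ∘ isPairedMin (extend v c)) (newPos ∷ newNeg ∷ []) ≡ bonus c
  ∑-isPairedMin-new fixedPair =
    cong₂ (λ a b → 𝟙 a + (𝟙 b + 0)) (isPairedMin-singleton (cycleEnding-fixedPair false))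
                                     (isPairedMin-singleton (cycleEnding-fixedPair true))
  ∑-isPairedMin-new unpairedPair =
    cong₂ (λ a b → 𝟙 a + (𝟙 b + 0)) (isPairedMin-unpaired (cycleEnding-unpairedPair false))
                                     (isPairedMin-unpaired (cycleEnding-unpairedPair true))
  ∑-isPairedMin-new (before y) =
    cong₂ (λ a b → 𝟙 (a ∧ not (unpairedAt w newPos)) + (𝟙 (b ∧ not (unpairedAt w newNeg)) + 0))
          (isCycleMin-before-new y false) (isCycleMin-before-new y true)
    where
    w : SVec (suc n)
    w = extend v (before y)

  wordBlock-new : ∀ c → wordBlock (extend v c) (fromℕ n) ≡ newCycleWord c
  wordBlock-new fixedPair = begin
    cycleBlock (isCycleMin w newPos) (unpairedAt w newPos) (cycleEnding w newNeg) (cycleEnding w newPos)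
      ≡⟨ cong₂ (λ a b → cycleBlock a b (cycleEnding w newNeg) (cycleEnding w newPos))
               (isCycleMin-singleton (cycleEnding-fixedPair false)) (unpairedAt-singleton (cycleEnding-fixedPair false)) ⟩
    cycleEnding w newNeg ++ cycleEnding w newPos
      ≡⟨ cong₂ _++_ (cycleEnding-fixedPair true) (cycleEnding-fixedPair false) ⟩
    newNeg ∷ newPos ∷ [] ∎
    where
    open ≡-Reasoning
    w : SVec (suc n)
    w = extend v fixedPair
  wordBlock-new unpairedPair = begin
    cycleBlock (isCycleMin w newPos) (unpairedAt w newPos) (cycleEnding w newNeg) (cycleEnding w newPos)
      ≡⟨ cong₂ (λ a b → cycleBlock a b (cycleEnding w newNeg) (cycleEnding w newPos))
               (isCycleMin-2cycle (cycleEnding-unpairedPair false)) (unpairedAt-2cycle (cycleEnding-unpairedPair false)) ⟩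
    cycleEnding w newNeg
      ≡⟨ cycleEnding-unpairedPair true ⟩
    newPos ∷ newNeg ∷ [] ∎
    where
    open ≡-Reasoning
    w : SVec (suc n)
    w = extend v unpairedPair
  wordBlock-new (before y) =
    cong (λ a → cycleBlock a (unpairedAt w newPos) (cycleEnding w newNeg) (cycleEnding w newPos)) (isCycleMin-before-new y false)
    where
    w : SVec (suc n)
    w = extend v (before y)

module _ {n} {v : SVec n} (c : Choice n) (v-perm : IsSignedPerm v) where

  private
    w : SVec (suc n)
    w = extend v c

  pairedCycles-extend : pairedCycles w ≡ pairedCycles v + bonus c
  pairedCycles-extend = begin
    length (filterᵇ (isPairedMin w) (allElts (suc n)))
      ≡⟨ length-filter (T? ∘ isPairedMin w) (allElts (suc n)) ⟩
    ∑ (𝟙 ∘ isPairedMin w) (allElts (suc n))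
      ≡⟨ cong (∑ (𝟙 ∘ isPairedMin w)) (allElts-suc n) ⟩
    ∑ (𝟙 ∘ isPairedMin w) (map lift (allElts n) ++ newPos ∷ newNeg ∷ [])
      ≡⟨ ∑-++ (𝟙 ∘ isPairedMin w) (map lift (allElts n)) _ ⟩
    ∑ (𝟙 ∘ isPairedMin w) (map lift (allElts n)) + ∑ (𝟙 ∘ isPairedMin w) (newPos ∷ newNeg ∷ [])
      ≡⟨ cong₂ _+_ (∑-map (𝟙 ∘ isPairedMin w) lift (allElts n)) (∑-isPairedMin-new v-perm c) ⟩
    ∑ (𝟙 ∘ isPairedMin w ∘ lift) (allElts n) + bonus c
      ≡⟨ cong (_+ bonus c) (∑-cong-∈ (allElts n) (λ {z} _ → cong 𝟙 (isPairedMin-lift z))) ⟩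
    ∑ (𝟙 ∘ isPairedMin v) (allElts n) + bonus c
      ≡⟨ cong (_+ bonus c) (length-filter (T? ∘ isPairedMin v) (allElts n)) ⟨
    pairedCycles v + bonus c ∎
    where
    open ≡-Reasoning
    isPairedMin-lift : ∀ z → isPairedMin w (lift z) ≡ isPairedMin v z
    isPairedMin-lift z = cong₂ (λ isMin unpaired → isMin ∧ not unpaired)
                               (isCycleMin-extend-lift c v-perm z) (unpairedAt-extend-lift c v-perm z)

  standardWord-extend : standardWord w ≡ insertNew c (standardWord v) ++ newCycleWord c
  standardWord-extend = begin
    standardWord w
      ≡⟨ standardWord-blocks w ⟩
    concatMap (wordBlock w) (allFin (suc n))
      ≡⟨ cong (concatMap (wordBlock w)) (allFin-suc n) ⟩
    concatMap (wordBlock w) (map inject₁ (allFin n) ++ [ fromℕ n ])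
      ≡⟨ List.concatMap-++ (wordBlock w) (map inject₁ (allFin n)) _ ⟩
    concatMap (wordBlock w) (map inject₁ (allFin n)) ++ wordBlock w (fromℕ n) ++ []
      ≡⟨ cong₂ _++_ (List.concatMap-map (wordBlock w) inject₁ (allFin n)) (List.++-identityʳ _) ⟩
    concatMap (wordBlock w ∘ inject₁) (allFin n) ++ wordBlock w (fromℕ n)
      ≡⟨ cong₂ _++_ (List.concatMap-cong (wordBlock-extend-inject₁ c v-perm) (allFin n)) (wordBlock-new v-perm c) ⟩
    concatMap (insertNew c ∘ wordBlock v) (allFin n) ++ newCycleWord c
      ≡⟨ cong (_++ newCycleWord c) (insertNew-concatMap c (wordBlock v) (allFin n)) ⟩
    insertNew c (standardWord v) ++ newCycleWord c ∎
    where open ≡-Reasoning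

-- Inversions of an extension

invElts : ∀ {n} → List (Elt n) → ℕ
invElts xs = invWord (map toℤ xs)

beats : ∀ {n} → Elt n → Elt n → Bool
beats e u = ⌊ ℤ.+ ∣ toℤ u ∣ <ℤ? toℤ e ⌋

invElts-∷ : ∀ {n} (e : Elt n) xs → invElts (e ∷ xs) ≡ ∑ (𝟙 ∘ beats e) xs + invElts xs
invElts-∷ e xs = cong (_+ invElts xs)
  (trans (length-filter _ (map toℤ xs)) (∑-map (𝟙 ∘ λ y → ⌊ ℤ.+ ∣ y ∣ <ℤ? toℤ e ⌋) toℤ xs))

∣toℤ∣ : ∀ {n} (u : Elt n) → ∣ toℤ u ∣ ≡ suc (absE u)
∣toℤ∣ (false , i) = refl
∣toℤ∣ (true , i) = refl

beats-positive : ∀ {n} i (u : Elt n) → absE u < toℕ i → beats (false , i) u ≡ true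
beats-positive i u u<i with ℤ.+ ∣ toℤ u ∣ <ℤ? toℤ (false , i)
... | yes _ = refl
... | no ≮ = ⊥-elim (≮ (subst (λ k → ℤ.+ k ℤ.< _) (sym (∣toℤ∣ u)) (ℤ.+<+ (s≤s u<i))))

beats-positive-not : ∀ {n} i (u : Elt n) → toℕ i ≤ absE u → beats (false , i) u ≡ false
beats-positive-not i u i≤u with ℤ.+ ∣ toℤ u ∣ <ℤ? toℤ (false , i)
... | yes < = ⊥-elim (ℕ.<⇒≱ (s<s⁻¹ (ℤ.drop‿+<+ (subst (λ k → ℤ.+ k ℤ.< _) (∣toℤ∣ u) <))) i≤u)
... | no _ = refl

beats-negative : ∀ {n} i (u : Elt n) → beats (true , i) u ≡ false
beats-negative i u with ℤ.+ ∣ toℤ u ∣ <ℤ? toℤ (true , i)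
... | yes ()
... | no _ = refl

beats-lift : ∀ {n} (e u : Elt n) → beats (lift e) (lift u) ≡ beats e u
beats-lift e u = cong₂ (λ a b → ⌊ ℤ.+ ∣ a ∣ <ℤ? b ⌋) (toℤ-lift u) (toℤ-lift e)

beats-lift-new : ∀ {n} (e : Elt n) s → beats (lift e) (s , fromℕ n) ≡ false
beats-lift-new {n} (false , i) s = beats-positive-not (inject₁ i) (s , fromℕ n)
  (subst₂ _≤_ (sym (Fin.toℕ-inject₁ i)) (sym (Fin.toℕ-fromℕ _)) (ℕ.<⇒≤ (Fin.toℕ<n i)))
beats-lift-new {n} (true , i) s = beats-negative (inject₁ i) (s , fromℕ n)

beats-newPos-lift : ∀ {n} (u : Elt n) → beats newPos (lift u) ≡ true
beats-newPos-lift u = beats-positive _ (lift u) (subst₂ _<_ (sym (absE-lift u)) (sym (absE-new false)) (absE<n u))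

beats-newPos-new : ∀ {n} s → beats (newPos {n}) (s , fromℕ n) ≡ false
beats-newPos-new s = beats-positive-not _ (s , _) ℕ.≤-refl

-- The inversions whose larger entry is the letter inserted in front of z, when z
-- is followed by W: n+1 exceeds |·| of z and of every later letter, -n-1 exceeds
-- nothing.
markerInversions : ∀ {n} → Choice n → Elt n → List (Elt n) → ℕ
markerInversions (before y) z W = if eqE z y then suc (length W) else 0
markerInversions _ _ _ = 0

newInversions : ∀ {n} → Choice n → List (Elt n) → ℕ
newInversions c [] = 0
newInversions c (z ∷ W) = markerInversions c z W + newInversions c W

newInversions-unmarked : ∀ {n} {c : Choice n} → (∀ z W → markerInversions c z W ≡ 0) → ∀ W → newInversions c W ≡ 0
newInversions-unmarked unmarked [] = refl
newInversions-unmarked unmarked (z ∷ W) = cong₂ _+_ (unmarked z W) (newInversions-unmarked unmarked W)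

Lifted-extendedWord : ∀ {n} (c : Choice n) W → Lifted (insertNew c W ++ newCycleWord c) W
Lifted-extendedWord fixedPair W = Lifted-++-new true false (Lifted-insertNew fixedPair W)
Lifted-extendedWord unpairedPair W = Lifted-++-new false true (Lifted-insertNew unpairedPair W)
Lifted-extendedWord (before y) W = subst (λ xs → Lifted xs W) (sym (List.++-identityʳ _)) (Lifted-insertNew (before y) W)

invElts-newCycleWord : ∀ {n} (c : Choice n) → invElts (newCycleWord c) ≡ 0
invElts-newCycleWord {n} fixedPair =
  trans (invElts-∷ (newNeg {n}) (newPos ∷ [])) (cong (λ b → 𝟙 b + 0 + 0) (beats-negative (fromℕ n) newPos))
invElts-newCycleWord {n} unpairedPair =
  trans (invElts-∷ (newPos {n}) (newNeg ∷ [])) (cong (λ b → 𝟙 b + 0 + 0) (beats-newPos-new {n} true))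
invElts-newCycleWord (before y) = refl

module _ {n} {R : List (Elt (suc n))} {W : List (Elt n)} (lifted : Lifted R W) where

  ∑-beats-lift : ∀ z → ∑ (𝟙 ∘ beats (lift z)) R ≡ ∑ (𝟙 ∘ beats z) W
  ∑-beats-lift z = trans (∑-Lifted _ (λ s → cong 𝟙 (beats-lift-new z s)) lifted)
                         (∑-cong-∈ W (λ {u} _ → cong 𝟙 (beats-lift z u)))

  ∑-beats-newPos : ∑ (𝟙 ∘ beats newPos) R ≡ length W
  ∑-beats-newPos = trans (∑-Lifted _ (λ s → cong 𝟙 (beats-newPos-new s)) lifted)
                         (∑-one W (λ u → cong 𝟙 (beats-newPos-lift u)))

  invElts-lift-∷ : ∀ z → invElts (lift z ∷ R) ≡ ∑ (𝟙 ∘ beats z) W + invElts R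
  invElts-lift-∷ z = trans (invElts-∷ (lift z) R) (cong (_+ invElts R) (∑-beats-lift z))

  invElts-block : ∀ c z → invElts (block c z ++ R) ≡ markerInversions c z W + (∑ (𝟙 ∘ beats z) W + invElts R)
  invElts-block fixedPair z = invElts-lift-∷ z
  invElts-block unpairedPair z = invElts-lift-∷ z
  invElts-block (before y) z = from (near y z)
    where
    open ≡-Reasoning
    rest : ℕ
    rest = ∑ (𝟙 ∘ beats z) W + invElts R
    marker≡ : ∀ {b} → eqE z y ≡ b → markerInversions (before y) z W + rest ≡ (if b then suc (length W) else 0) + rest
    marker≡ eq = cong (λ b → (if b then suc (length W) else 0) + rest) eq
    from : Near y z → invElts (block (before y) z ++ R) ≡ markerInversions (before y) z W + rest
    from (at z≡y) = begin
      invElts (block (before y) z ++ R)                     ≡⟨ cong (λ b → invElts (b ++ R)) (block-at z≡y) ⟩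
      invElts (newPos ∷ lift z ∷ R)                         ≡⟨ invElts-∷ newPos (lift z ∷ R) ⟩
      (𝟙 (beats newPos (lift z)) + ∑ (𝟙 ∘ beats newPos) R) + invElts (lift z ∷ R)
        ≡⟨ cong₂ _+_ (cong₂ _+_ (cong 𝟙 (beats-newPos-lift z)) ∑-beats-newPos) (invElts-lift-∷ z) ⟩
      suc (length W) + rest                                  ≡⟨ marker≡ (trans (cong (eqE z) (sym z≡y)) (eqE-refl z)) ⟨
      markerInversions (before y) z W + rest                 ∎
    from (atNeg z≡-y) = begin
      invElts (block (before y) z ++ R)                     ≡⟨ cong (λ b → invElts (b ++ R)) (block-atNeg z≡-y) ⟩
      invElts (newNeg ∷ lift z ∷ R)                         ≡⟨ invElts-∷ newNeg (lift z ∷ R) ⟩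
      ∑ (𝟙 ∘ beats newNeg) (lift z ∷ R) + invElts (lift z ∷ R)
        ≡⟨ cong₂ _+_ (∑-zero (lift z ∷ R) (λ u → cong 𝟙 (beats-negative (fromℕ n) u))) (invElts-lift-∷ z) ⟩
      0 + rest                                               ≡⟨ marker≡ (eqE-≢ (λ z≡y → negE≢self y (trans (sym z≡-y) z≡y))) ⟨
      markerInversions (before y) z W + rest                 ∎
    from (far z≢y z≢-y) = begin
      invElts (block (before y) z ++ R)                     ≡⟨ cong (λ b → invElts (b ++ R)) (block-far z≢y z≢-y) ⟩
      invElts (lift z ∷ R)                                  ≡⟨ invElts-lift-∷ z ⟩
      0 + rest                                               ≡⟨ marker≡ (eqE-≢ z≢y) ⟨
      markerInversions (before y) z W + rest                 ∎

invElts-extend : ∀ {n} (c : Choice n) W → invElts (insertNew c W ++ newCycleWord c) ≡ newInversions c W + invElts W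
invElts-extend c [] = invElts-newCycleWord c
invElts-extend {n} c (z ∷ W) = begin
  invElts ((block c z ++ insertNew c W) ++ newCycleWord c)
    ≡⟨ cong invElts (List.++-assoc (block c z) (insertNew c W) (newCycleWord c)) ⟩
  invElts (block c z ++ R)                           ≡⟨ invElts-block (Lifted-extendedWord c W) c z ⟩
  m + (b + invElts R)                                ≡⟨ cong (λ i → m + (b + i)) (invElts-extend c W) ⟩
  m + (b + (newInversions c W + invElts W))          ≡⟨ shuffle m b (newInversions c W) (invElts W) ⟩
  newInversions c (z ∷ W) + (b + invElts W)          ≡⟨ cong (newInversions c (z ∷ W) +_) (invElts-∷ z W) ⟨
  newInversions c (z ∷ W) + invElts (z ∷ W)          ∎
  where
  open ≡-Reasoning
  R : List (Elt (suc n))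
  R = insertNew c W ++ newCycleWord c
  m b : ℕ
  m = markerInversions c z W
  b = ∑ (𝟙 ∘ beats z) W
  shuffle : ∀ a b x i → a + (b + (x + i)) ≡ (a + x) + (b + i)
  shuffle = +-*-Solver.solve 4 (λ a b x i → a :+ (b :+ (x :+ i)) := (a :+ x) :+ (b :+ i)) refl
    where open +-*-Solver

inv-extend : ∀ {n} {v : SVec n} c → IsSignedPerm v → inv (extend v c) ≡ newInversions c (standardWord v) + inv v
inv-extend {v = v} c v-perm =
  trans (cong invElts (standardWord-extend c v-perm)) (invElts-extend c (standardWord v))

-- A common left inverse of lift and of redirect y.
origin : ∀ {n} → Elt n → Elt (suc n) → Elt n
origin y x with eltView x
... | new false = y
... | new true = negE y
... | lifted a = a

origin-lift : ∀ {n} (y z : Elt n) → origin y (lift z) ≡ z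
origin-lift y (s , i) rewrite Top.view-inject₁ i = refl

origin-newPos : ∀ {n} (y : Elt n) → origin y newPos ≡ y
origin-newPos {n} y rewrite Top.view-fromℕ n = refl

origin-newNeg : ∀ {n} (y : Elt n) → origin y newNeg ≡ negE y
origin-newNeg {n} y rewrite Top.view-fromℕ n = refl

origin-block : ∀ {n} (y z : Elt n) {x} → x ∈ block (before y) z → origin y x ≡ z
origin-block y z {x} x∈ = from (near y z)
  where
  from : Near y z → origin y x ≡ z
  from (at z≡y) with subst (x ∈_) (block-at z≡y) x∈
  ... | here refl = trans (origin-newPos y) (sym z≡y)
  ... | there (here refl) = origin-lift y z
  from (atNeg z≡-y) with subst (x ∈_) (block-atNeg z≡-y) x∈
  ... | here refl = trans (origin-newNeg y) (sym z≡-y)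
  ... | there (here refl) = origin-lift y z
  from (far z≢y z≢-y) with subst (x ∈_) (block-far z≢y z≢-y) x∈
  ... | here refl = origin-lift y z

lift∈block : ∀ {n} (c : Choice n) z → lift z ∈ block c z
lift∈block fixedPair z = here refl
lift∈block unpairedPair z = here refl
lift∈block (before y) z with near y z
... | at _ = there (here refl)
... | atNeg _ = there (here refl)
... | far _ _ = here refl

block-unique : ∀ {n} (c : Choice n) z → Unique (block c z)
block-unique fixedPair z = [] ∷ []
block-unique unpairedPair z = [] ∷ []
block-unique (before y) z with near y z
... | at _ = ((λ eq → lift≢new z false (sym eq)) ∷ []) ∷ [] ∷ []
... | atNeg _ = ((λ eq → lift≢new z true (sym eq)) ∷ []) ∷ [] ∷ []
... | far _ _ = [] ∷ []

blocks-disjoint : ∀ {n} (c : Choice n) {z z′} → z ≢ z′ → Disjoint (block c z) (block c z′)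
blocks-disjoint fixedPair z≢z′ (here refl , here eq) = z≢z′ (lift-injective eq)
blocks-disjoint unpairedPair z≢z′ (here refl , here eq) = z≢z′ (lift-injective eq)
blocks-disjoint (before y) {z} {z′} z≢z′ (∈z , ∈z′) = z≢z′ (trans (sym (origin-block y z ∈z)) (origin-block y z′ ∈z′))


insertNew-unique : ∀ {n} (c : Choice n) {W} → Unique W → Unique (insertNew c W)
insertNew-unique c {W} = Unique-concatMap (All.universal (block-unique c) W) (blocks-disjoint c)

newCycleWord-new : ∀ {n} (c : Choice n) {x} → x ∈ newCycleWord c → ∃ λ s → x ≡ (s , fromℕ n)
newCycleWord-new fixedPair (here refl) = true , refl
newCycleWord-new fixedPair (there (here refl)) = false , refl
newCycleWord-new unpairedPair (here refl) = false , refl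
newCycleWord-new unpairedPair (there (here refl)) = true , refl

insertNew-newCycleWord-disjoint : ∀ {n} (c : Choice n) W → Disjoint (insertNew c W) (newCycleWord c)
insertNew-newCycleWord-disjoint (before y) W (_ , ())
insertNew-newCycleWord-disjoint fixedPair W (x∈ , x∈new) = lifted≢new (∈-concatMap-elim (block fixedPair) W x∈) (newCycleWord-new fixedPair x∈new)
  where
  lifted≢new : ∀ {x} → (∃ λ z → z ∈ W × x ∈ lift z ∷ []) → (∃ λ s → x ≡ (s , fromℕ _)) → _
  lifted≢new (z , _ , here refl) (s , eq) = lift≢new z s eq
insertNew-newCycleWord-disjoint unpairedPair W (x∈ , x∈new) = lifted≢new (∈-concatMap-elim (block unpairedPair) W x∈) (newCycleWord-new unpairedPair x∈new)
  where
  lifted≢new : ∀ {x} → (∃ λ z → z ∈ W × x ∈ lift z ∷ []) → (∃ λ s → x ≡ (s , fromℕ _)) → _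
  lifted≢new (z , _ , here refl) (s , eq) = lift≢new z s eq

newCycleWord-unique : ∀ {n} (c : Choice n) → Unique (newCycleWord c)
newCycleWord-unique fixedPair = ((λ ()) ∷ []) ∷ [] ∷ []
newCycleWord-unique unpairedPair = ((λ ()) ∷ []) ∷ [] ∷ []
newCycleWord-unique (before y) = []

IsEnumeration : ∀ {n} → List (Elt n) → Set
IsEnumeration W = Unique W × (∀ z → z ∈ W)

extendedWord-complete : ∀ {n} (c : Choice n) {W} → (∀ z → z ∈ W) → ∀ x → x ∈ insertNew c W ++ newCycleWord c
extendedWord-complete c {W} complete x with eltView x
... | lifted a = viaBlock c a (lift∈block c a)
  where
  viaBlock : ∀ c {x} z → x ∈ block c z → x ∈ insertNew c W ++ newCycleWord c
  viaBlock c z x∈ = List∈.∈-++⁺ˡ (∈-concatMap-intro (block c) x∈ (complete z))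
extendedWord-complete fixedPair {W} _ _ | new false = List∈.∈-++⁺ʳ (insertNew fixedPair W) (there (here refl))
extendedWord-complete fixedPair {W} _ _ | new true = List∈.∈-++⁺ʳ (insertNew fixedPair W) (here refl)
extendedWord-complete unpairedPair {W} _ _ | new false = List∈.∈-++⁺ʳ (insertNew unpairedPair W) (here refl)
extendedWord-complete unpairedPair {W} _ _ | new true = List∈.∈-++⁺ʳ (insertNew unpairedPair W) (there (here refl))
extendedWord-complete (before y) complete _ | new false =
  List∈.∈-++⁺ˡ (∈-concatMap-intro (block (before y)) (subst (newPos ∈_) (sym (block-at refl)) (here refl)) (complete y))
extendedWord-complete (before y) complete _ | new true =
  List∈.∈-++⁺ˡ (∈-concatMap-intro (block (before y)) (subst (newNeg ∈_) (sym (block-atNeg refl)) (here refl)) (complete (negE y)))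

extendedWord-isEnumeration : ∀ {n} (c : Choice n) {W} → IsEnumeration W → IsEnumeration (insertNew c W ++ newCycleWord c)
extendedWord-isEnumeration c {W} (unique , complete) =
  Unique.++⁺ (insertNew-unique c unique) (newCycleWord-unique c) (insertNew-newCycleWord-disjoint c W) ,
  extendedWord-complete c complete

standardWord-isEnumeration : ∀ {n} (v : SVec n) → IsSignedPerm v → IsEnumeration (standardWord v)
standardWord-isEnumeration {zero} Vec.[] _ = [] , λ { (_ , ()) }
standardWord-isEnumeration {suc n} v v-perm with extend-surjective v v-perm
... | v′ , c , v′-perm , refl =
  subst IsEnumeration (sym (standardWord-extend c v′-perm))
        (extendedWord-isEnumeration c (standardWord-isEnumeration v′ v′-perm))

length-enumeration : ∀ {n} {W : List (Elt n)} → IsEnumeration W → length W ≡ 2 * n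
length-enumeration {n} (unique , complete) = trans
  (↭.↭-length (∼bag⇒↭ (unique∧set⇒bag unique (allElts-unique n) (mk⇔ (λ _ → allElts-complete _) (λ _ → complete _)))))
  (length-allElts n)

choices : ∀ {n} → SVec n → List (Choice n)
choices v = fixedPair ∷ unpairedPair ∷ map before (standardWord v)

choices-unique : ∀ {n} {v : SVec n} → IsSignedPerm v → Unique (choices v)
choices-unique {v = v} v-perm =
  ((λ ()) ∷ All.map⁺ (All.universal (λ _ ()) (standardWord v))) ∷
  All.map⁺ (All.universal (λ _ ()) (standardWord v)) ∷
  Unique.map⁺ before-injective (proj₁ (standardWord-isEnumeration v v-perm))
  where
  before-injective : ∀ {y y′} → before y ≡ before y′ → y ≡ y′
  before-injective refl = refl

choices-complete : ∀ {n} {v : SVec n} → IsSignedPerm v → ∀ c → c ∈ choices v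
choices-complete v-perm fixedPair = here refl
choices-complete v-perm unpairedPair = there (here refl)
choices-complete {v = v} v-perm (before y) =
  there (there (List∈.∈-map⁺ before (proj₂ (standardWord-isEnumeration v v-perm) y)))

candidates : ∀ n → List (SVec (suc n))
candidates n = concatMap (λ v → map (extend v) (choices v)) (signedPerms n)

candidates-unique : ∀ n → Unique (candidates n)
candidates-unique n = Unique-concatMap
  (All.tabulate (λ {v} v∈ → Unique.map⁺ (λ {c} {c′} eq → proj₂ (extend-injective {v = v} {v} {c} {c′} eq))
                                        (choices-unique (signedPerms-sound v∈))))
  disjoint (signedPerms-unique n)
  where
  disjoint : ∀ {v v′} → v ≢ v′ → Disjoint (map (extend v) (choices v)) (map (extend v′) (choices v′))
  disjoint {v} {v′} v≢v′ (∈v , ∈v′) with List∈.∈-map⁻ (extend v) {xs = choices v} ∈v | List∈.∈-map⁻ (extend v′) {xs = choices v′} ∈v′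
  ... | c , _ , refl | c′ , _ , eq = v≢v′ (proj₁ (extend-injective {v = v} {v′} {c} {c′} eq))

signedPerms-suc↭candidates : ∀ n → signedPerms (suc n) ↭ candidates n
signedPerms-suc↭candidates n =
  ∼bag⇒↭ (unique∧set⇒bag (signedPerms-unique (suc n)) (candidates-unique n) (mk⇔ to from))
  where
  to : ∀ {w} → w ∈ signedPerms (suc n) → w ∈ candidates n
  to {w} w∈ with extend-surjective w (signedPerms-sound w∈)
  ... | v , c , v-perm , refl =
    ∈-concatMap-intro _ (List∈.∈-map⁺ (extend v) (choices-complete v-perm c)) (signedPerms-complete v-perm)
  from : ∀ {w} → w ∈ candidates n → w ∈ signedPerms (suc n)
  from w∈ with ∈-concatMap-elim (λ v → map (extend v) (choices v)) (signedPerms n) w∈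
  ... | v , v∈ , w∈′ with List∈.∈-map⁻ (extend v) {xs = choices v} w∈′
  ... | c , _ , refl = signedPerms-complete (extend-isSignedPerm c (signedPerms-sound v∈))

-- Counting

newInversions-∉ : ∀ {n} {y : Elt n} W → y ∉ W → newInversions (before y) W ≡ 0
newInversions-∉ [] _ = refl
newInversions-∉ {y = y} (z ∷ W) y∉ = cong₂ _+_
  (cong (λ b → if b then suc (length W) else 0) (eqE-≢ (λ z≡y → y∉ (here (sym z≡y)))))
  (newInversions-∉ W (y∉ ∘ there))

∑-newInversions : ∀ {n} (g : ℕ → ℕ) (W : List (Elt n)) → Unique W →
                  ∑ (λ y → g (newInversions (before y) W)) W ≡ ∑ (g ∘ suc) (upTo (length W))
∑-newInversions g [] _ = refl
∑-newInversions g (z ∷ W) (z∉ ∷ unique) = begin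
  g (newInversions (before z) (z ∷ W)) + ∑ (λ y → g (newInversions (before y) (z ∷ W))) W
    ≡⟨ cong₂ _+_ (cong g own) (∑-cong-∈ W (λ y∈ → cong g (others y∈))) ⟩
  g (suc (length W)) + ∑ (λ y → g (newInversions (before y) W)) W
    ≡⟨ cong (g (suc (length W)) +_) (∑-newInversions g W unique) ⟩
  g (suc (length W)) + ∑ (g ∘ suc) (upTo (length W))
    ≡⟨ ℕ.+-comm (g (suc (length W))) _ ⟩
  ∑ (g ∘ suc) (upTo (length W)) + g (suc (length W))
    ≡⟨ ∑-upTo-last (g ∘ suc) (length W) ⟨
  ∑ (g ∘ suc) (upTo (suc (length W))) ∎
  where
  open ≡-Reasoning
  z∉W : z ∉ W
  z∉W z∈ = All.lookup z∉ z∈ refl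
  own : newInversions (before z) (z ∷ W) ≡ suc (length W)
  own = trans (cong (λ b → (if b then suc (length W) else 0) + newInversions (before z) W) (eqE-refl z))
              (trans (cong (suc (length W) +_) (newInversions-∉ W z∉W)) (ℕ.+-identityʳ _))
  others : ∀ {y} → y ∈ W → newInversions (before y) (z ∷ W) ≡ newInversions (before y) W
  others {y} y∈ = cong (λ b → (if b then suc (length W) else 0) + newInversions (before y) W)
                       (eqE-≢ (λ z≡y → z∉W (subst (_∈ W) (sym z≡y) y∈)))

indicator : ℕ → ℕ → ℕ → ℕ → ℕ
indicator k d p i = 𝟙 (does ((p ≟ 2 * k) ×-dec (i ≟ d)))

indicator-suc-zero : ∀ k p i → indicator k 0 p (suc i) ≡ 0
indicator-suc-zero k p i = cong 𝟙 (∧-zeroʳ (does (p ≟ 2 * k)))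

indicator-+2-zero : ∀ d p i → indicator 0 d (p + 2) i ≡ 0
indicator-+2-zero d p i = cong (λ q → 𝟙 (does ((q ≟ 0) ×-dec (i ≟ d)))) (ℕ.+-comm p 2)

indicator-+2-suc : ∀ k d p i → indicator (suc k) d (p + 2) i ≡ indicator k d p i
indicator-+2-suc k d p i = cong₂ (λ q r → 𝟙 (does ((q ≟ r) ×-dec (i ≟ d)))) (ℕ.+-comm p 2) (ℕ.*-suc 2 k)

-- The number of permutations of ⟨m⟩' with 2k paired cycles and d - j inversions
-- (none when j > d).
shiftedCount : ℕ → ℕ → ℕ → ℕ → ℕ
shiftedCount m k j d = ∑ (λ v → indicator k d (pairedCycles v) (j + inv v)) (signedPerms m)

-- Permutations obtained through fixedPair gain two paired cycles.
fixedPairCount : ℕ → ℕ → ℕ → ℕ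
fixedPairCount m k d = ∑ (λ v → indicator k d (pairedCycles v + 2) (inv v)) (signedPerms m)

count≡shiftedCount : ∀ n k d →
  length (filter (λ v → (pairedCycles v ≟ 2 * k) ×-dec (inv v ≟ d)) (signedPerms n)) ≡ shiftedCount n k 0 d
count≡shiftedCount n k d = length-filter (λ v → (pairedCycles v ≟ 2 * k) ×-dec (inv v ≟ d)) (signedPerms n)

∑-choices : ∀ {m} {v : SVec m} k d → IsSignedPerm v →
  ∑ (λ c → indicator k d (pairedCycles (extend v c)) (inv (extend v c))) (choices v) ≡
  indicator k d (pairedCycles v + 2) (inv v) + ∑ (λ j → indicator k d (pairedCycles v) (j + inv v)) (upTo (suc (2 * m)))
∑-choices {m} {v} k d v-perm = begin
  ∑ (λ c → indicator k d (pairedCycles (extend v c)) (inv (extend v c))) (choices v)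
    ≡⟨ ∑-cong-∈ (choices v) (λ {c} _ → cong₂ (indicator k d) (pairedCycles-extend c v-perm) (inv-extend c v-perm)) ⟩
  ∑ (λ c → indicator k d (pairedCycles v + bonus c) (newInversions c W + inv v)) (choices v)
    ≡⟨ cong₂ _+_ (cong (λ i → indicator k d (pairedCycles v + 2) (i + inv v)) (newInversions-unmarked (λ _ _ → refl) W))
                 (cong₂ _+_ (cong₂ g′ (ℕ.+-identityʳ (pairedCycles v)) (newInversions-unmarked (λ _ _ → refl) W))
                            before-terms) ⟩
  indicator k d (pairedCycles v + 2) (inv v) + (g 0 + ∑ (g ∘ suc) (upTo (2 * m)))
    ≡⟨ cong (indicator k d (pairedCycles v + 2) (inv v) +_) (∑-upTo-suc g (2 * m)) ⟨
  indicator k d (pairedCycles v + 2) (inv v) + ∑ g (upTo (suc (2 * m))) ∎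
  where
  open ≡-Reasoning
  W : List (Elt m)
  W = standardWord v
  g′ : ℕ → ℕ → ℕ
  g′ p j = indicator k d p (j + inv v)
  g : ℕ → ℕ
  g = g′ (pairedCycles v)
  enumeration : IsEnumeration W
  enumeration = standardWord-isEnumeration v v-perm
  before-terms : ∑ (λ c → indicator k d (pairedCycles v + bonus c) (newInversions c W + inv v)) (map before W) ≡ ∑ (g ∘ suc) (upTo (2 * m))
  before-terms = begin
    ∑ (λ c → indicator k d (pairedCycles v + bonus c) (newInversions c W + inv v)) (map before W)
      ≡⟨ ∑-map _ before W ⟩
    ∑ (λ y → g′ (pairedCycles v + 0) (newInversions (before y) W)) W
      ≡⟨ cong (λ p → ∑ (λ y → g′ p (newInversions (before y) W)) W) (ℕ.+-identityʳ (pairedCycles v)) ⟩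
    ∑ (λ y → g (newInversions (before y) W)) W
      ≡⟨ ∑-newInversions g W (proj₁ enumeration) ⟩
    ∑ (g ∘ suc) (upTo (length W))
      ≡⟨ cong (∑ (g ∘ suc) ∘ upTo) (length-enumeration enumeration) ⟩
    ∑ (g ∘ suc) (upTo (2 * m)) ∎

shiftedCount-suc : ∀ m k d → shiftedCount (suc m) k 0 d ≡ fixedPairCount m k d + ∑ (λ j → shiftedCount m k j d) (upTo (suc (2 * m)))
shiftedCount-suc m k d = begin
  ∑ (λ w → indicator k d (pairedCycles w) (inv w)) (signedPerms (suc m))
    ≡⟨ ∑-↭ _ (signedPerms-suc↭candidates m) ⟩
  ∑ (λ w → indicator k d (pairedCycles w) (inv w)) (candidates m)
    ≡⟨ ∑-concatMap _ (λ v → map (extend v) (choices v)) (signedPerms m) ⟩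
  ∑ (λ v → ∑ (λ w → indicator k d (pairedCycles w) (inv w)) (map (extend v) (choices v))) (signedPerms m)
    ≡⟨ ∑-cong-∈ (signedPerms m) (λ {v} v∈ → trans (∑-map (λ w → indicator k d (pairedCycles w) (inv w)) (extend v) (choices v))
                                                     (∑-choices k d (signedPerms-sound v∈))) ⟩
  ∑ (λ v → indicator k d (pairedCycles v + 2) (inv v) + ∑ (λ j → indicator k d (pairedCycles v) (j + inv v)) (upTo (suc (2 * m)))) (signedPerms m)
    ≡⟨ ∑-+ _ _ (signedPerms m) ⟩
  fixedPairCount m k d + ∑ (λ v → ∑ (λ j → indicator k d (pairedCycles v) (j + inv v)) (upTo (suc (2 * m)))) (signedPerms m)
    ≡⟨ cong (fixedPairCount m k d +_) (∑-comm (λ v j → indicator k d (pairedCycles v) (j + inv v)) (signedPerms m) (upTo (suc (2 * m)))) ⟩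
  fixedPairCount m k d + ∑ (λ j → shiftedCount m k j d) (upTo (suc (2 * m))) ∎
  where open ≡-Reasoning

fixedPairCount-zero : ∀ m d → fixedPairCount m 0 d ≡ 0
fixedPairCount-zero m d = ∑-zero (signedPerms m) (λ v → indicator-+2-zero d (pairedCycles v) (inv v))

fixedPairCount-suc : ∀ m k d → fixedPairCount m (suc k) d ≡ shiftedCount m k 0 d
fixedPairCount-suc m k d = ∑-cong-∈ (signedPerms m) (λ {v} _ → indicator-+2-suc k d (pairedCycles v) (inv v))

coeff-⊕ : ∀ p q d → coeff (p ⊕ q) d ≡ coeff p d + coeff q d
coeff-⊕ [] q d = refl
coeff-⊕ (a ∷ p) [] d = sym (ℕ.+-identityʳ _)
coeff-⊕ (a ∷ p) (b ∷ q) zero = refl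
coeff-⊕ (a ∷ p) (b ∷ q) (suc d) = coeff-⊕ p q d

coeff-map-1* : ∀ p d → coeff (map (1 *_) p) d ≡ coeff p d
coeff-map-1* [] d = refl
coeff-map-1* (a ∷ p) zero = ℕ.+-identityʳ a
coeff-map-1* (a ∷ p) (suc d) = coeff-map-1* p d

-- The hypotheses say that Ψ j d is the coefficient of q^d in q^j p.
coeff-qint-⊛ : ∀ p (Ψ : ℕ → ℕ → ℕ) → (∀ d → Ψ 0 d ≡ coeff p d) → (∀ j d → Ψ (suc j) (suc d) ≡ Ψ j d) →
               (∀ j → Ψ (suc j) 0 ≡ 0) → ∀ r d → coeff (qint r ⊛ p) d ≡ ∑ (λ j → Ψ j d) (upTo r)
coeff-qint-⊛ p Ψ Ψ₀ Ψ-suc Ψ-0 zero d = refl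
coeff-qint-⊛ p Ψ Ψ₀ Ψ-suc Ψ-0 (suc r) zero = begin
  coeff (map (1 *_) p ⊕ (0 ∷ qint r ⊛ p)) 0          ≡⟨ coeff-⊕ (map (1 *_) p) (0 ∷ qint r ⊛ p) 0 ⟩
  coeff (map (1 *_) p) 0 + 0                         ≡⟨ cong₂ _+_ (trans (coeff-map-1* p 0) (sym (Ψ₀ 0))) (sym (∑-zero (upTo r) Ψ-0)) ⟩
  Ψ 0 0 + ∑ (λ j → Ψ (suc j) 0) (upTo r)            ≡⟨ ∑-upTo-suc (λ j → Ψ j 0) r ⟨
  ∑ (λ j → Ψ j 0) (upTo (suc r))                    ∎
  where open ≡-Reasoning
coeff-qint-⊛ p Ψ Ψ₀ Ψ-suc Ψ-0 (suc r) (suc d) = begin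
  coeff (map (1 *_) p ⊕ (0 ∷ qint r ⊛ p)) (suc d)    ≡⟨ coeff-⊕ (map (1 *_) p) (0 ∷ qint r ⊛ p) (suc d) ⟩
  coeff (map (1 *_) p) (suc d) + coeff (qint r ⊛ p) d
      ≡⟨ cong₂ _+_ (trans (coeff-map-1* p (suc d)) (sym (Ψ₀ (suc d)))) (coeff-qint-⊛ p Ψ Ψ₀ Ψ-suc Ψ-0 r d) ⟩
  Ψ 0 (suc d) + ∑ (λ j → Ψ j d) (upTo r)            ≡⟨ cong (Ψ 0 (suc d) +_) (∑-cong-∈ (upTo r) (λ {j} _ → sym (Ψ-suc j d))) ⟩
  Ψ 0 (suc d) + ∑ (λ j → Ψ (suc j) (suc d)) (upTo r) ≡⟨ ∑-upTo-suc (λ j → Ψ j (suc d)) r ⟨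
  ∑ (λ j → Ψ j (suc d)) (upTo (suc r))              ∎
  where open ≡-Reasoning

module _ (m : ℕ) (ih : ∀ k d → coeff (cB m k) d ≡ shiftedCount m k 0 d) where

  coeff-qint-⊛-cB : ∀ k d → coeff (qint (2 * m + 1) ⊛ cB m k) d ≡ ∑ (λ j → shiftedCount m k j d) (upTo (suc (2 * m)))
  coeff-qint-⊛-cB k d = trans
    (coeff-qint-⊛ (cB m k) (λ j d → shiftedCount m k j d) (λ d → sym (ih k d)) (λ j d → refl)
       (λ j → ∑-zero (signedPerms m) (λ v → indicator-suc-zero k (pairedCycles v) (j + inv v))) (2 * m + 1) d)
    (cong (λ r → ∑ (λ j → shiftedCount m k j d) (upTo r)) (ℕ.+-comm (2 * m) 1))

  coeff-cB-suc : ∀ k d → coeff (cB (suc m) k) d ≡ fixedPairCount m k d + ∑ (λ j → shiftedCount m k j d) (upTo (suc (2 * m)))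
  coeff-cB-suc zero d =
    trans (coeff-qint-⊛-cB 0 d) (cong (_+ ∑ (λ j → shiftedCount m 0 j d) (upTo (suc (2 * m)))) (sym (fixedPairCount-zero m d)))
  coeff-cB-suc (suc k) d =
    trans (coeff-⊕ (cB m k) (qint (2 * m + 1) ⊛ cB m (suc k)) d)
          (cong₂ _+_ (trans (ih k d) (sym (fixedPairCount-suc m k d))) (coeff-qint-⊛-cB (suc k) d))

theorem3p17 : (n k d : ℕ) →
    coeff (cB n k) d ≡
      length (filter (λ v → (pairedCycles v ≟ 2 * k) ×-dec (inv v ≟ d)) (signedPerms n))
theorem3p17 zero zero zero = refl
theorem3p17 zero zero (suc d) = refl
theorem3p17 zero (suc k) d = refl
theorem3p17 (suc m) k d = begin
  coeff (cB (suc m) k) d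
    ≡⟨ coeff-cB-suc m (λ k d → trans (theorem3p17 m k d) (count≡shiftedCount m k d)) k d ⟩
  fixedPairCount m k d + ∑ (λ j → shiftedCount m k j d) (upTo (suc (2 * m)))
    ≡⟨ shiftedCount-suc m k d ⟨
  shiftedCount (suc m) k 0 d
    ≡⟨ count≡shiftedCount (suc m) k d ⟨
  length (filter (λ v → (pairedCycles v ≟ 2 * k) ×-dec (inv v ≟ d)) (signedPerms (suc m))) ∎
  where open ≡-Reasoning
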